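{- Let $(z_{l,p})_{(l,p)\in\mathbb{N}^2}$ be a double sequence of real numbers such that $z_{0,p}=0$ for every $p\in\mathbb{N}$ and, for every $l,p>0$, $$z_{l,p}=2z_{l-1,p}+\sum_{q=0}^{p-1}\binom{p}{q}2^{(p-q)(l-1)}z_{l-1,q}.$$ Then for every $l\ge0$ and every $p>0$, $$z_{l,p}=-\frac{2^l}{p+1}\sum_{j=1}^{l-1}\Bigg(\sum_{i=1}^{p}\binom{p+1}{i}(2^i-1)2^{(p-i)l+(i-1)j}B_i\Bigg)z_{j,0}.$$
   Context: $B_i$ denotes the $i$-th Bernoulli number (first kind), $B_0=1$, $B_1=-1/2$, defined by $\sum_{k=0}^m\binom{m+1}{k}B_k=0$ for $m\ge1$. Empty sums are $0$. -}

module Defs where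

open import Level using (Level; _⊔_)
open import Data.Nat as ℕ using (ℕ; zero; suc; _∸_; _≤_)
open import Data.Nat.Combinatorics using (_C_)
open import Data.Integer as ℤ using (+_)
open import Data.Rational as ℚ using (ℚ; _/_)
open import Data.Rational.Properties using (+-*-commutativeRing)
open import Data.Vec using (Vec; []; _∷_; _∷ʳ_; lookup)
open import Data.Fin using (Fin; fromℕ<)
open import Relation.Nullary using (yes; no)
open import Algebra.Bundles using (CommutativeRing)
open import Algebra.Morphism.Structures using (module RingMorphisms)

ℕ→ℚ : ℕ → ℚ
ℕ→ℚ n = (+ n) / 1

-- ∑[ a , n ] f  =  f a + f (a+1) + ... + f (a+n-1)   (n terms; empty sum = 0)
∑ℚ : ℕ → ℕ → (ℕ → ℚ) → ℚ
∑ℚ a zero    f = ℚ.0ℚ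
∑ℚ a (suc n) f = f a ℚ.+ ∑ℚ (suc a) n f

-- Bernoulli numbers B_0 .. B_n (first kind, B_1 = -1/2), via
-- B_0 = 1 and, for m ≥ 1, sum_{k=0}^{m} C(m+1,k) B_k = 0, i.e.
-- B_m = -(1/(m+1)) * sum_{k=0}^{m-1} C(m+1,k) B_k.
bernoulliVec : (n : ℕ) → Vec ℚ (suc n)
bernoulliVec zero    = ℚ.1ℚ ∷ []
bernoulliVec (suc n) = prev ∷ʳ next
  where
  prev : Vec ℚ (suc n)
  prev = bernoulliVec n
  get : ℕ → ℚ
  get k with k ℕ.<? suc n
  ... | yes k<  = lookup prev (fromℕ< k<)
  ... | no _    = ℚ.0ℚ
  next : ℚ
  next = ℚ.- (((+ 1) / suc (suc n))
              ℚ.* ∑ℚ 0 (suc n) (λ k → ℕ→ℚ ((suc (suc n)) C k) ℚ.* get k))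

B : ℕ → ℚ
B n = lookup (bernoulliVec n) (Data.Fin.fromℕ n)

module _ {c ℓ : Level} (R : CommutativeRing c ℓ) where
  open CommutativeRing R

  ∑R : ℕ → ℕ → (ℕ → Carrier) → Carrier
  ∑R a zero    f = 0#
  ∑R a (suc n) f = f a + ∑R (suc a) n f

-- "R is a ℚ-algebra": ι is a unital ring homomorphism ℚ → R
IsℚAlgebraMap : {c ℓ : Level} (R : CommutativeRing c ℓ) →
                (ℚ → CommutativeRing.Carrier R) → Set ℓ
IsℚAlgebraMap R ι =
  RingMorphisms.IsRingHomomorphism
    (CommutativeRing.rawRing +-*-commutativeRing)
    (CommutativeRing.rawRing R) ι

{-# OPTIONS --safe #-}
module Submission where

-- Write P_p(n) = Σ_{k<n} k^p.  For l = j + 1 + e, Faulhaber's formula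
-- (p+1) P_p(n) = Σ_{i≤p} C(p+1,i) n^{p+1-i} B_i collapses the coefficient of z_{j,0} in the
-- claimed formula to 2^{jp} (P_p(2^{e+1}) - 2^{p+1} P_p(2^e)).  The binomial expansion
-- P_p(2M) = P_p(M) + Σ_q C(p,q) M^{p-q} P_q(M) shows that these coefficients obey the recursion
-- defining z_{l,p}, the q = 0 term of the recursion supplying the new coefficient 2^{p(l-1)}
-- of z_{l-1,0}; induction on l concludes.

open import Defs
open import Level using (Level)
open import Data.Nat using (ℕ; suc; _∸_; _≤_; _^_)
open import Data.Nat.Combinatorics using (_C_)
open import Data.Integer using (+_)
open import Data.Rational using (ℚ; _/_)
open import Algebra.Bundles using (CommutativeRing; CommutativeSemiring)
import Data.Nat as N
import Data.Rational as Q
open import Relation.Binary.PropositionalEquality as P using (_≡_)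

module FiniteSum {c ℓ : Level} (S : CommutativeSemiring c ℓ) where

  open import Data.Nat using (zero; _<_; s≤s)
  open import Data.Nat.Properties
    using (≤-refl; <⇒≤; m≤m+n; +-suc; +-∸-assoc; n∸n≡0; ≤-pred)
    renaming (+-identityʳ to ℕ-+-identityʳ; +-comm to ℕ-+-comm)
  open CommutativeSemiring S
  open import Relation.Binary.Reasoning.Setoid setoid

  ∑ : ℕ → ℕ → (ℕ → Carrier) → Carrier
  ∑ a zero    f = 0#
  ∑ a (suc n) f = f a + ∑ (suc a) n f

  ∑-cong-on : ∀ a n {f g : ℕ → Carrier} →
              (∀ k → a ≤ k → k < a N.+ n → f k ≈ g k) → ∑ a n f ≈ ∑ a n g
  ∑-cong-on a zero    f≈g = refl
  ∑-cong-on a (suc n) {f} {g} f≈g = +-cong (f≈g a ≤-refl a<a+1+n) (∑-cong-on (suc a) n f≈g′)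
    where
    a<a+1+n : a < a N.+ suc n
    a<a+1+n = P.subst (a <_) (P.sym (+-suc a n)) (s≤s (m≤m+n a n))
    f≈g′ : ∀ k → suc a ≤ k → k < suc a N.+ n → f k ≈ g k
    f≈g′ k a<k k<1+a+n = f≈g k (<⇒≤ a<k) (P.subst (k <_) (P.sym (+-suc a n)) k<1+a+n)

  ∑-cong : ∀ a n {f g : ℕ → Carrier} → (∀ k → f k ≈ g k) → ∑ a n f ≈ ∑ a n g
  ∑-cong a n f≈g = ∑-cong-on a n (λ k _ _ → f≈g k)

  ∑-zero : ∀ a n → ∑ a n (λ _ → 0#) ≈ 0#
  ∑-zero a zero    = refl
  ∑-zero a (suc n) = trans (+-identityˡ _) (∑-zero (suc a) n)

  ∑-vanishing : ∀ a n (f : ℕ → Carrier) →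
                (∀ k → a ≤ k → k < a N.+ n → f k ≈ 0#) → ∑ a n f ≈ 0#
  ∑-vanishing a n f f≈0 = trans (∑-cong-on a n f≈0) (∑-zero a n)

  ∑-distrib-+ : ∀ a n (f g : ℕ → Carrier) → ∑ a n (λ k → f k + g k) ≈ ∑ a n f + ∑ a n g
  ∑-distrib-+ a zero    f g = sym (+-identityˡ _)
  ∑-distrib-+ a (suc n) f g = begin
    (f a + g a) + ∑ (suc a) n (λ k → f k + g k) ≈⟨ +-congˡ (∑-distrib-+ (suc a) n f g) ⟩
    (f a + g a) + (F + G)                         ≈⟨ +-assoc _ _ _ ⟩
    f a + (g a + (F + G))                         ≈⟨ +-congˡ (sym (+-assoc _ _ _)) ⟩
    f a + ((g a + F) + G)                         ≈⟨ +-congˡ (+-congʳ (+-comm _ _)) ⟩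
    f a + ((F + g a) + G)                         ≈⟨ +-congˡ (+-assoc _ _ _) ⟩
    f a + (F + (g a + G))                         ≈⟨ sym (+-assoc _ _ _) ⟩
    (f a + F) + (g a + G)                         ∎
    where
    F : Carrier
    F = ∑ (suc a) n f
    G : Carrier
    G = ∑ (suc a) n g

  ∑-distribˡ : ∀ a n x (f : ℕ → Carrier) → x * ∑ a n f ≈ ∑ a n (λ k → x * f k)
  ∑-distribˡ a zero    x f = zeroʳ x
  ∑-distribˡ a (suc n) x f = trans (distribˡ x _ _) (+-congˡ (∑-distribˡ (suc a) n x f))

  ∑-distribʳ : ∀ a n x (f : ℕ → Carrier) → ∑ a n f * x ≈ ∑ a n (λ k → f k * x)
  ∑-distribʳ a n x f =
    trans (*-comm _ _) (trans (∑-distribˡ a n x f) (∑-cong a n (λ k → *-comm x (f k))))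

  ∑-comm : ∀ a n b m (f : ℕ → ℕ → Carrier) →
           ∑ a n (λ i → ∑ b m (f i)) ≈ ∑ b m (λ j → ∑ a n (λ i → f i j))
  ∑-comm a zero    b m f = sym (∑-zero b m)
  ∑-comm a (suc n) b m f = begin
    ∑ b m (f a) + ∑ (suc a) n (λ i → ∑ b m (f i))         ≈⟨ +-congˡ (∑-comm (suc a) n b m f) ⟩
    ∑ b m (f a) + ∑ b m (λ j → ∑ (suc a) n (λ i → f i j)) ≈⟨ sym (∑-distrib-+ b m _ _) ⟩
    ∑ b m (λ j → f a j + ∑ (suc a) n (λ i → f i j))       ∎

  ∑-suc : ∀ a n (f : ℕ → Carrier) → ∑ (suc a) n f ≡ ∑ a n (λ k → f (suc k))
  ∑-suc a zero    f = P.refl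
  ∑-suc a (suc n) f = P.cong (λ x → f (suc a) + x) (∑-suc (suc a) n f)

  ∑-translate : ∀ a n (f : ℕ → Carrier) → ∑ a n f ≡ ∑ 0 n (λ k → f (a N.+ k))
  ∑-translate zero    n f = P.refl
  ∑-translate (suc a) n f = P.trans (∑-suc a n f) (∑-translate a n (λ k → f (suc k)))

  ∑-split : ∀ a m n (f : ℕ → Carrier) → ∑ a (m N.+ n) f ≈ ∑ a m f + ∑ (a N.+ m) n f
  ∑-split a zero    n f =
    trans (reflexive (P.cong (λ b → ∑ b n f) (P.sym (ℕ-+-identityʳ a)))) (sym (+-identityˡ _))
  ∑-split a (suc m) n f = begin
    f a + ∑ (suc a) (m N.+ n) f                   ≈⟨ +-congˡ (∑-split (suc a) m n f) ⟩
    f a + (∑ (suc a) m f + ∑ (suc a N.+ m) n f)   ≈⟨ sym (+-assoc _ _ _) ⟩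
    (f a + ∑ (suc a) m f) + ∑ (suc a N.+ m) n f   ≈⟨ +-congˡ (reflexive (P.cong (λ b → ∑ b n f) (P.sym (+-suc a m)))) ⟩
    (f a + ∑ (suc a) m f) + ∑ (a N.+ suc m) n f   ∎

  ∑-last : ∀ a n (f : ℕ → Carrier) → ∑ a (suc n) f ≈ ∑ a n f + f (a N.+ n)
  ∑-last a n f = begin
    ∑ a (suc n) f               ≡⟨ P.cong (λ m → ∑ a m f) (ℕ-+-comm 1 n) ⟩
    ∑ a (n N.+ 1) f               ≈⟨ ∑-split a n 1 f ⟩
    ∑ a n f + (f (a N.+ n) + 0#)  ≈⟨ +-congˡ (+-identityʳ _) ⟩
    ∑ a n f + f (a N.+ n)         ∎

  ∑-extend : ∀ a m k (f : ℕ → Carrier) →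
             (∀ j → a N.+ m ≤ j → j < a N.+ m N.+ k → f j ≈ 0#) → ∑ a (m N.+ k) f ≈ ∑ a m f
  ∑-extend a m k f f≈0 =
    trans (∑-split a m k f) (trans (+-congˡ (∑-vanishing (a N.+ m) k f f≈0)) (+-identityʳ _))

  ∑-reverse : ∀ n (f : ℕ → Carrier) → ∑ 0 n f ≈ ∑ 1 n (λ r → f (n ∸ r))
  ∑-reverse zero    f = refl
  ∑-reverse (suc n) f = begin
    f 0 + ∑ 1 n f                               ≡⟨ P.cong (λ x → f 0 + x) (∑-suc 0 n f) ⟩
    f 0 + ∑ 0 n (λ k → f (suc k))               ≈⟨ +-congˡ (∑-reverse n (λ k → f (suc k))) ⟩
    f 0 + ∑ 1 n (λ r → f (suc (n ∸ r)))         ≈⟨ +-congˡ (∑-cong-on 1 n (λ r _ r≤n →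
                                                     reflexive (P.cong f (P.sym (+-∸-assoc 1 (≤-pred r≤n)))))) ⟩
    f 0 + ∑ 1 n (λ r → f (suc n ∸ r))           ≈⟨ +-comm _ _ ⟩
    ∑ 1 n (λ r → f (suc n ∸ r)) + f 0           ≡⟨ P.cong (λ m → ∑ 1 n (λ r → f (suc n ∸ r)) + f m) (P.sym (n∸n≡0 n)) ⟩
    ∑ 1 n (λ r → f (suc n ∸ r)) + f (n ∸ n)     ≈⟨ sym (∑-last 1 n _) ⟩
    ∑ 1 (suc n) (λ r → f (suc n ∸ r))           ∎

module BinomialCoefficients where

  open import Data.Nat using (zero; _+_; _*_; _<_; _>_; _!; NonZero)
  open import Data.Nat.Properties
  open import Data.Nat.Combinatorics using (nCk≡n!/k![n-k]!; k![n∸k]!∣n!; k>n⇒nCk≡0)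
  open import Data.Nat.DivMod using (m/n*n≡m)
  open import Data.Nat.Tactic.RingSolver using (solve-∀)
  open import Data.Sum using (inj₁; inj₂)
  open import Data.Fin using (toℕ)
  open import Algebra.Properties.CommutativeSemiring.Binomial +-*-commutativeSemiring
    using () renaming (theorem to semiring-binomial-theorem)
  open import Algebra.Properties.Semiring.Exp +-*-semiring using () renaming (_^_ to _^′_)
  open import Algebra.Definitions.RawMonoid N.+-0-rawMonoid using (sum; _×_)
  open P using (refl; cong; cong₂; sym; trans; subst)
  open P.≡-Reasoning
  open FiniteSum +-*-commutativeSemiring

  nCk*k!*[n∸k]!≡n! : ∀ {n k} → k ≤ n → (n C k) * (k ! * (n ∸ k) !) ≡ n !
  nCk*k!*[n∸k]!≡n! {n} {k} k≤n =
    trans (cong (_* (k ! * (n ∸ k) !)) (nCk≡n!/k![n-k]! k≤n))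
          (m/n*n≡m {{_!*_!≢0 k (n ∸ k)}} (k![n∸k]!∣n! k≤n))

  nCi*[n∸i]Cr*i!*r!*[n∸i∸r]!≡n! : ∀ n i r → i + r ≤ n →
    (n C i) * ((n ∸ i) C r) * (i ! * (r ! * (n ∸ i ∸ r) !)) ≡ n !
  nCi*[n∸i]Cr*i!*r!*[n∸i∸r]!≡n! n i r i+r≤n = begin
    (n C i) * ((n ∸ i) C r) * (i ! * (r ! * (n ∸ i ∸ r) !))
      ≡⟨ regroup (n C i) ((n ∸ i) C r) (i !) (r ! * (n ∸ i ∸ r) !) ⟩
    (n C i) * i ! * (((n ∸ i) C r) * (r ! * (n ∸ i ∸ r) !))
      ≡⟨ cong ((n C i) * i ! *_) (nCk*k!*[n∸k]!≡n! r≤n∸i) ⟩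
    (n C i) * i ! * (n ∸ i) !
      ≡⟨ *-assoc (n C i) (i !) _ ⟩
    (n C i) * (i ! * (n ∸ i) !)
      ≡⟨ nCk*k!*[n∸k]!≡n! (≤-trans (m≤m+n i r) i+r≤n) ⟩
    n ! ∎
    where
    regroup : ∀ a b c d → a * b * (c * d) ≡ a * c * (b * d)
    regroup = solve-∀
    r≤n∸i : r ≤ n ∸ i
    r≤n∸i = subst (_≤ n ∸ i) (m+n∸m≡n i r) (∸-monoˡ-≤ i i+r≤n)

  nCi*[n∸i]Cr≡0 : ∀ n i r → i + r > n → (n C i) * ((n ∸ i) C r) ≡ 0
  nCi*[n∸i]Cr≡0 n i r i+r>n with ≤-<-connex i n
  ... | inj₂ i>n = cong (_* ((n ∸ i) C r)) (k>n⇒nCk≡0 i>n)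
  ... | inj₁ i≤n = trans (cong ((n C i) *_) (k>n⇒nCk≡0 r>n∸i)) (*-zeroʳ (n C i))
    where
    r>n∸i : r > n ∸ i
    r>n∸i = +-cancelˡ-< i _ _ (subst (_< i + r) (sym (m+[n∸m]≡n i≤n)) i+r>n)

  nCi*[n∸i]Cr≡nCr*[n∸r]Ci : ∀ n i r → (n C i) * ((n ∸ i) C r) ≡ (n C r) * ((n ∸ r) C i)
  nCi*[n∸i]Cr≡nCr*[n∸r]Ci n i r with ≤-<-connex (i + r) n
  ... | inj₂ i+r>n =
    trans (nCi*[n∸i]Cr≡0 n i r i+r>n) (sym (nCi*[n∸i]Cr≡0 n r i (subst (_> n) (+-comm i r) i+r>n)))
  ... | inj₁ i+r≤n = *-cancelʳ-≡ _ _ (i ! * (r ! * (n ∸ i ∸ r) !)) {{nonZero}} (begin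
    (n C i) * ((n ∸ i) C r) * (i ! * (r ! * (n ∸ i ∸ r) !)) ≡⟨ nCi*[n∸i]Cr*i!*r!*[n∸i∸r]!≡n! n i r i+r≤n ⟩
    n !                                                      ≡⟨ nCi*[n∸i]Cr*i!*r!*[n∸i∸r]!≡n! n r i r+i≤n ⟨
    (n C r) * ((n ∸ r) C i) * (r ! * (i ! * (n ∸ r ∸ i) !))  ≡⟨ cong ((n C r) * ((n ∸ r) C i) *_) factorials-comm ⟩
    (n C r) * ((n ∸ r) C i) * (i ! * (r ! * (n ∸ i ∸ r) !))  ∎)
    where
    r+i≤n : r + i ≤ n
    r+i≤n = subst (_≤ n) (+-comm i r) i+r≤n
    nonZero : NonZero (i ! * (r ! * (n ∸ i ∸ r) !))
    nonZero = m*n≢0 _ _ {{i !≢0}} {{m*n≢0 _ _ {{r !≢0}} {{(n ∸ i ∸ r) !≢0}}}}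
    factorials-comm : r ! * (i ! * (n ∸ r ∸ i) !) ≡ i ! * (r ! * (n ∸ i ∸ r) !)
    factorials-comm = begin
      r ! * (i ! * (n ∸ r ∸ i) !) ≡⟨ cong (λ m → r ! * (i ! * m !)) ∸-swap ⟩
      r ! * (i ! * (n ∸ i ∸ r) !) ≡⟨ swap-front (r !) (i !) _ ⟩
      i ! * (r ! * (n ∸ i ∸ r) !) ∎
      where
      ∸-swap : n ∸ r ∸ i ≡ n ∸ i ∸ r
      ∸-swap = trans (∸-+-assoc n r i) (trans (cong (n ∸_) (+-comm r i)) (sym (∸-+-assoc n i r)))
      swap-front : ∀ a b c → a * (b * c) ≡ b * (a * c)
      swap-front = solve-∀

  binomial-theorem : ∀ n x y → (x + y) ^ n ≡ ∑ 0 (suc n) (λ k → (n C k) * (x ^ k * y ^ (n ∸ k)))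
  binomial-theorem n x y = begin
    (x + y) ^ n
      ≡⟨ ^′≡^ (x + y) n ⟨
    (x + y) ^′ n
      ≡⟨ semiring-binomial-theorem n x y ⟩
    sum {suc n} (λ k → (n C toℕ k) × (x ^′ toℕ k * y ^′ (n ∸ toℕ k)))
      ≡⟨ sum≡∑ (suc n) (λ k → (n C k) × (x ^′ k * y ^′ (n ∸ k))) ⟩
    ∑ 0 (suc n) (λ k → (n C k) × (x ^′ k * y ^′ (n ∸ k)))
      ≡⟨ ∑-cong 0 (suc n) (λ k → trans (×≡* (n C k) _) (cong₂ (λ a b → (n C k) * (a * b)) (^′≡^ x k) (^′≡^ y (n ∸ k)))) ⟩
    ∑ 0 (suc n) (λ k → (n C k) * (x ^ k * y ^ (n ∸ k))) ∎
    where
    ^′≡^ : ∀ x n → x ^′ n ≡ x ^ n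
    ^′≡^ x zero    = refl
    ^′≡^ x (suc n) = cong (x *_) (^′≡^ x n)
    ×≡* : ∀ n x → n × x ≡ n * x
    ×≡* zero    x = refl
    ×≡* (suc n) x = cong (λ y → x + y) (×≡* n x)
    sum≡∑ : ∀ n (f : ℕ → ℕ) → sum {n} (λ i → f (toℕ i)) ≡ ∑ 0 n f
    sum≡∑ zero    f = refl
    sum≡∑ (suc n) f = cong (λ y → f 0 + y) (trans (sum≡∑ n (λ k → f (suc k))) (sym (∑-suc 0 n f)))

  nCi*[1+x]^[n∸i]≡∑ : ∀ n i x → i ≤ n →
    (n C i) * suc x ^ (n ∸ i) ≡ ∑ 0 (suc n) (λ r → (n C r) * ((n ∸ r) C i) * x ^ r)
  nCi*[1+x]^[n∸i]≡∑ n i x i≤n = begin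
    (n C i) * suc x ^ m
      ≡⟨ cong (λ y → (n C i) * y ^ m) (+-comm 1 x) ⟩
    (n C i) * (x + 1) ^ m
      ≡⟨ cong ((n C i) *_) (binomial-theorem m x 1) ⟩
    (n C i) * ∑ 0 (suc m) (λ r → (m C r) * (x ^ r * 1 ^ (m ∸ r)))
      ≡⟨ ∑-distribˡ 0 (suc m) (n C i) _ ⟩
    ∑ 0 (suc m) (λ r → (n C i) * ((m C r) * (x ^ r * 1 ^ (m ∸ r))))
      ≡⟨ ∑-cong 0 (suc m) (λ r → drop-1^ (n C i) (m C r) (x ^ r) (m ∸ r)) ⟩
    ∑ 0 (suc m) g
      ≡⟨ ∑-extend 0 (suc m) i g (λ r m<r _ → trans (cong (λ c → (n C i) * c * x ^ r) (k>n⇒nCk≡0 m<r)) (cong (_* x ^ r) (*-zeroʳ (n C i)))) ⟨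
    ∑ 0 (suc m + i) g
      ≡⟨ cong (λ k → ∑ 0 (suc k) g) (m∸n+n≡m i≤n) ⟩
    ∑ 0 (suc n) g
      ≡⟨ ∑-cong 0 (suc n) (λ r → cong (_* x ^ r) (nCi*[n∸i]Cr≡nCr*[n∸r]Ci n i r)) ⟩
    ∑ 0 (suc n) (λ r → (n C r) * ((n ∸ r) C i) * x ^ r) ∎
    where
    m : ℕ
    m = n ∸ i
    g : ℕ → ℕ
    g r = (n C i) * (m C r) * x ^ r
    drop-1^ : ∀ a b c k → a * (b * (c * 1 ^ k)) ≡ a * b * c
    drop-1^ a b c k = begin
      a * (b * (c * 1 ^ k)) ≡⟨ cong (λ y → a * (b * y)) (trans (cong (c *_) (^-zeroˡ k)) (*-identityʳ c)) ⟩
      a * (b * c)           ≡⟨ *-assoc a b c ⟨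
      a * b * c             ∎

module PowerSums where

  open import Data.Nat using (zero; _+_; _*_)
  open import Data.Nat.Properties
  open import Data.Nat.Tactic.RingSolver using (solve-∀)
  open P using (refl; cong; trans)
  open P.≡-Reasoning
  open FiniteSum +-*-commutativeSemiring
  open BinomialCoefficients using (binomial-theorem)

  powerSum : ℕ → ℕ → ℕ
  powerSum p n = ∑ 0 n (λ k → k ^ p)

  powerSum-0 : ∀ n → powerSum 0 n ≡ n
  powerSum-0 n = ∑1≡n 0 n
    where
    ∑1≡n : ∀ a n → ∑ a n (λ _ → 1) ≡ n
    ∑1≡n a zero    = refl
    ∑1≡n a (suc n) = cong suc (∑1≡n (suc a) n)

  powerSum-double : ∀ p n →
    powerSum p (n + n) ≡ powerSum p n + ∑ 0 (suc p) (λ q → (p C q) * (n ^ (p ∸ q) * powerSum q n))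
  powerSum-double p n = begin
    powerSum p (n + n)
      ≡⟨ ∑-split 0 n n _ ⟩
    powerSum p n + ∑ n n (λ k → k ^ p)
      ≡⟨ cong (λ s → powerSum p n + s) (∑-translate n n _) ⟩
    powerSum p n + ∑ 0 n (λ k → (n + k) ^ p)
      ≡⟨ cong (λ s → powerSum p n + s) (∑-cong 0 n (λ k → trans (cong (_^ p) (+-comm n k)) (binomial-theorem p k n))) ⟩
    powerSum p n + ∑ 0 n (λ k → ∑ 0 (suc p) (λ q → (p C q) * (k ^ q * n ^ (p ∸ q))))
      ≡⟨ cong (λ s → powerSum p n + s) (∑-comm 0 n 0 (suc p) _) ⟩
    powerSum p n + ∑ 0 (suc p) (λ q → ∑ 0 n (λ k → (p C q) * (k ^ q * n ^ (p ∸ q))))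
      ≡⟨ cong (λ s → powerSum p n + s) (∑-cong 0 (suc p) pull-out) ⟩
    powerSum p n + ∑ 0 (suc p) (λ q → (p C q) * (n ^ (p ∸ q) * powerSum q n)) ∎
    where
    pull-out : ∀ q → ∑ 0 n (λ k → (p C q) * (k ^ q * n ^ (p ∸ q))) ≡ (p C q) * (n ^ (p ∸ q) * powerSum q n)
    pull-out q = begin
      ∑ 0 n (λ k → (p C q) * (k ^ q * n ^ (p ∸ q)))   ≡⟨ ∑-cong 0 n (λ k → rearrange (p C q) (n ^ (p ∸ q)) (k ^ q)) ⟩
      ∑ 0 n (λ k → (p C q) * n ^ (p ∸ q) * k ^ q)     ≡⟨ ∑-distribˡ 0 n ((p C q) * n ^ (p ∸ q)) (λ k → k ^ q) ⟨
      (p C q) * n ^ (p ∸ q) * powerSum q n            ≡⟨ *-assoc (p C q) (n ^ (p ∸ q)) (powerSum q n) ⟩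
      (p C q) * (n ^ (p ∸ q) * powerSum q n)          ∎
      where
      rearrange : ∀ a b c → a * (c * b) ≡ a * b * c
      rearrange = solve-∀

module PowersOfTwo where

  open import Data.Nat using (zero; _+_; _*_)
  open import Data.Nat.Properties
  open import Data.Nat.Tactic.RingSolver using (solve-∀)
  open P using (refl; cong; cong₂; sym; trans)
  open P.≡-Reasoning

  n+n≡2*n : ∀ n → n + n ≡ 2 * n
  n+n≡2*n n = cong (λ m → n + m) (sym (+-identityʳ n))

  2^n+2^n≡2^[1+n] : ∀ n → 2 ^ n + 2 ^ n ≡ 2 ^ suc n
  2^n+2^n≡2^[1+n] n = n+n≡2*n (2 ^ n)

  [m*n]^o≡m^o*n^o : ∀ m n o → (m * n) ^ o ≡ m ^ o * n ^ o
  [m*n]^o≡m^o*n^o m n zero    = refl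
  [m*n]^o≡m^o*n^o m n (suc o) = trans (cong (m * n *_) ([m*n]^o≡m^o*n^o m n o)) (interchange m n (m ^ o) (n ^ o))
    where
    interchange : ∀ a b c d → a * b * (c * d) ≡ a * c * (b * d)
    interchange = solve-∀

  [2^e+2^e]^k≡2^[[1+e]*k] : ∀ e k → (2 ^ e + 2 ^ e) ^ k ≡ 2 ^ (suc e * k)
  [2^e+2^e]^k≡2^[[1+e]*k] e k = trans (cong (_^ k) (2^n+2^n≡2^[1+n] e)) (^-*-assoc 2 (suc e) k)

  kernel-exponent : ∀ j e i p → 1 ≤ i → i ≤ p →
    (j + suc e) + ((p ∸ i) * (j + suc e) + (i ∸ 1) * j) ≡ j * p + suc e * (suc p ∸ i)
  kernel-exponent j e (suc i) p _ 1+i≤p = begin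
    (j + suc e) + (k * (j + suc e) + i * j) ≡⟨ regroup j e i k ⟩
    j * (suc i + k) + suc e * suc k         ≡⟨ cong₂ (λ a b → j * a + suc e * b) (m+[n∸m]≡n 1+i≤p) (sym (+-∸-assoc 1 1+i≤p)) ⟩
    j * p + suc e * (suc p ∸ suc i)         ∎
    where
    k : ℕ
    k = p ∸ suc i
    regroup : ∀ j e i k → (j + suc e) + (k * (j + suc e) + i * j) ≡ j * (suc i + k) + suc e * suc k
    regroup = solve-∀

  kernel-weight : ∀ j e i p → 1 ≤ i → i ≤ p →
    2 ^ (j + suc e) * ((suc p C i) * (2 ^ i ∸ 1) * 2 ^ ((p ∸ i) * (j + suc e) + (i ∸ 1) * j))
      + 2 ^ (j * p) * ((suc p C i) * (2 ^ e + 2 ^ e) ^ (suc p ∸ i))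
    ≡ 2 ^ (j * p) * (2 ^ suc p * ((suc p C i) * (2 ^ e) ^ (suc p ∸ i)))
  kernel-weight j e i p 1≤i i≤p = begin
    2 ^ l * (c * (2 ^ i ∸ 1) * 2 ^ E) + y * (c * W)  ≡⟨ cong (_+ y * (c * W)) (swap-front (2 ^ l) c (2 ^ i ∸ 1) (2 ^ E)) ⟩
    c * (2 ^ i ∸ 1) * (2 ^ l * 2 ^ E) + y * (c * W)  ≡⟨ cong (λ x → c * (2 ^ i ∸ 1) * x + y * (c * W)) 2^l*2^E≡y*W ⟩
    c * (2 ^ i ∸ 1) * (y * W) + y * (c * W)          ≡⟨ collect c (2 ^ i ∸ 1) y W ⟩
    y * (c * W * (2 ^ i ∸ 1 + 1))                    ≡⟨ cong (λ x → y * (c * W * x)) (m∸n+n≡m (m^n>0 2 i)) ⟩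
    y * (c * W * 2 ^ i)                              ≡⟨ cong (y *_) (trans (*-assoc c W (2 ^ i)) (cong (c *_) (trans (*-comm W (2 ^ i)) 2^i*W≡2^[1+p]*M^k))) ⟩
    y * (c * (2 ^ suc p * (2 ^ e) ^ k))              ≡⟨ cong (y *_) (swap-front′ c (2 ^ suc p) ((2 ^ e) ^ k)) ⟩
    y * (2 ^ suc p * (c * (2 ^ e) ^ k))              ∎
    where
    l : ℕ
    l = j + suc e
    E : ℕ
    E = (p ∸ i) * l + (i ∸ 1) * j
    c : ℕ
    c = suc p C i
    k : ℕ
    k = suc p ∸ i
    y : ℕ
    y = 2 ^ (j * p)
    W : ℕ
    W = (2 ^ e + 2 ^ e) ^ k
    swap-front : ∀ a c d b → a * (c * d * b) ≡ c * d * (a * b)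
    swap-front = solve-∀
    swap-front′ : ∀ c a b → c * (a * b) ≡ a * (c * b)
    swap-front′ = solve-∀
    collect : ∀ c d y w → c * d * (y * w) + y * (c * w) ≡ y * (c * w * (d + 1))
    collect = solve-∀
    2^l*2^E≡y*W : 2 ^ l * 2 ^ E ≡ y * W
    2^l*2^E≡y*W = begin
      2 ^ l * 2 ^ E              ≡⟨ ^-distribˡ-+-* 2 l E ⟨
      2 ^ (l + E)                ≡⟨ cong (2 ^_) (kernel-exponent j e i p 1≤i i≤p) ⟩
      2 ^ (j * p + suc e * k)    ≡⟨ ^-distribˡ-+-* 2 (j * p) (suc e * k) ⟩
      y * 2 ^ (suc e * k)        ≡⟨ cong (y *_) ([2^e+2^e]^k≡2^[[1+e]*k] e k) ⟨
      y * W                      ∎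
    2^i*W≡2^[1+p]*M^k : 2 ^ i * W ≡ 2 ^ suc p * (2 ^ e) ^ k
    2^i*W≡2^[1+p]*M^k = begin
      2 ^ i * W                     ≡⟨ cong (λ x → 2 ^ i * x ^ k) (2^n+2^n≡2^[1+n] e) ⟩
      2 ^ i * (2 * 2 ^ e) ^ k       ≡⟨ cong (2 ^ i *_) ([m*n]^o≡m^o*n^o 2 (2 ^ e) k) ⟩
      2 ^ i * (2 ^ k * (2 ^ e) ^ k) ≡⟨ *-assoc (2 ^ i) (2 ^ k) _ ⟨
      2 ^ i * 2 ^ k * (2 ^ e) ^ k   ≡⟨ cong (_* (2 ^ e) ^ k) (^-distribˡ-+-* 2 i k) ⟨
      2 ^ (i + k) * (2 ^ e) ^ k     ≡⟨ cong (λ x → 2 ^ x * (2 ^ e) ^ k) (m+[n∸m]≡n (m≤n⇒m≤1+n i≤p)) ⟩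
      2 ^ suc p * (2 ^ e) ^ k       ∎

  rescaled-coefficient : ∀ j e p q → q ≤ p →
    2 ^ (j * p) * ((p C q) * (2 ^ e + 2 ^ e) ^ (p ∸ q)) ≡ (p C q) * 2 ^ ((p ∸ q) * (j + suc e)) * 2 ^ (j * q)
  rescaled-coefficient j e p q q≤p = begin
    2 ^ (j * p) * ((p C q) * (2 ^ e + 2 ^ e) ^ k)    ≡⟨ cong (λ x → 2 ^ (j * p) * ((p C q) * x)) ([2^e+2^e]^k≡2^[[1+e]*k] e k) ⟩
    2 ^ (j * p) * ((p C q) * 2 ^ (suc e * k))        ≡⟨ swap-front (2 ^ (j * p)) (p C q) (2 ^ (suc e * k)) ⟩
    (p C q) * (2 ^ (j * p) * 2 ^ (suc e * k))        ≡⟨ cong ((p C q) *_) (^-distribˡ-+-* 2 (j * p) (suc e * k)) ⟨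
    (p C q) * 2 ^ (j * p + suc e * k)                ≡⟨ cong (λ x → (p C q) * 2 ^ (j * x + suc e * k)) (m∸n+n≡m q≤p) ⟨
    (p C q) * 2 ^ (j * (k + q) + suc e * k)          ≡⟨ cong (λ x → (p C q) * 2 ^ x) (regroup j k q e) ⟩
    (p C q) * 2 ^ (k * (j + suc e) + j * q)          ≡⟨ cong ((p C q) *_) (^-distribˡ-+-* 2 (k * (j + suc e)) (j * q)) ⟩
    (p C q) * (2 ^ (k * (j + suc e)) * 2 ^ (j * q))  ≡⟨ *-assoc (p C q) _ _ ⟨
    (p C q) * 2 ^ (k * (j + suc e)) * 2 ^ (j * q)    ∎
    where
    k : ℕ
    k = p ∸ q
    swap-front : ∀ a c b → a * (c * b) ≡ c * (a * b)
    swap-front = solve-∀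
    regroup : ∀ j k q e → j * (k + q) + suc e * k ≡ k * (j + suc e) + j * q
    regroup = solve-∀

  doubled-coefficient : ∀ p q M → q ≤ p →
    2 ^ suc p * ((p C q) * M ^ (p ∸ q)) ≡ (p C q) * (M + M) ^ (p ∸ q) * 2 ^ suc q
  doubled-coefficient p q M q≤p = begin
    2 ^ suc p * ((p C q) * M ^ k)         ≡⟨ cong (λ x → 2 ^ x * ((p C q) * M ^ k)) k+1+q≡1+p ⟨
    2 ^ (k + suc q) * ((p C q) * M ^ k)   ≡⟨ cong (_* ((p C q) * M ^ k)) (^-distribˡ-+-* 2 k (suc q)) ⟩
    2 ^ k * 2 ^ suc q * ((p C q) * M ^ k) ≡⟨ regroup (2 ^ k) (2 ^ suc q) (p C q) (M ^ k) ⟩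
    (p C q) * (2 ^ k * M ^ k) * 2 ^ suc q ≡⟨ cong (λ x → (p C q) * x * 2 ^ suc q) ([m*n]^o≡m^o*n^o 2 M k) ⟨
    (p C q) * (2 * M) ^ k * 2 ^ suc q     ≡⟨ cong (λ x → (p C q) * x ^ k * 2 ^ suc q) (n+n≡2*n M) ⟨
    (p C q) * (M + M) ^ k * 2 ^ suc q     ∎
    where
    k : ℕ
    k = p ∸ q
    k+1+q≡1+p : k + suc q ≡ suc p
    k+1+q≡1+p = trans (+-suc k q) (cong suc (m∸n+n≡m q≤p))
    regroup : ∀ a b c d → a * b * (c * d) ≡ c * (a * d) * b
    regroup = solve-∀

module RationalArithmetic where

  open import Data.Nat using (zero)
  open import Data.Nat.Properties using (*-identityˡ) renaming (+-*-commutativeSemiring to ℕ-semiring)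
  open import Data.Nat.Coprimality using (Coprime)
  open import Data.Nat.Divisibility using (∣1⇒≡1)
  open import Data.Product using (_,_)
  import Data.Integer as ℤ
  import Data.Integer.Properties as ℤP
  open import Data.Rational using (mkℚ)
  open import Data.Rational.Properties
    using (+-*-commutativeRing; _≟_; normalize-coprime; *-inverseʳ; /-cong)
  open import Level using (0ℓ)
  open import Relation.Nullary.Decidable using (dec⇒maybe)
  open import Tactic.RingSolver.Core.AlmostCommutativeRing
    using (AlmostCommutativeRing; fromCommutativeRing)
  open P using (refl; cong; cong₂; sym; trans)

  module ℕ∑ = FiniteSum ℕ-semiring
  module ℚ∑ = FiniteSum (CommutativeRing.commutativeSemiring +-*-commutativeRing)

  ℚ-ring : AlmostCommutativeRing 0ℓ 0ℓ
  ℚ-ring = fromCommutativeRing +-*-commutativeRing (λ x → dec⇒maybe (Q.0ℚ ≟ x))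

  private
    coprime-1 : ∀ n → Coprime n 1
    coprime-1 n (_ , d∣1) = ∣1⇒≡1 d∣1

    1-coprime : ∀ n → Coprime 1 n
    1-coprime n (d∣1 , _) = ∣1⇒≡1 d∣1

    ℕ→ℚ≡mkℚ : ∀ n → ℕ→ℚ n ≡ mkℚ (+ n) 0 (coprime-1 n)
    ℕ→ℚ≡mkℚ n = normalize-coprime (coprime-1 n)

    1/[1+n]≡mkℚ : ∀ n → (+ 1) / suc n ≡ mkℚ (+ 1) n (1-coprime (suc n))
    1/[1+n]≡mkℚ n = normalize-coprime (1-coprime (suc n))

  ℕ→ℚ-+ : ∀ a b → ℕ→ℚ (a N.+ b) ≡ ℕ→ℚ a Q.+ ℕ→ℚ b
  ℕ→ℚ-+ a b rewrite ℕ→ℚ≡mkℚ a | ℕ→ℚ≡mkℚ b =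
    cong (_/ 1) (trans (ℤP.pos-+ a b) (sym (cong₂ ℤ._+_ (ℤP.*-identityʳ (+ a)) (ℤP.*-identityʳ (+ b)))))

  ℕ→ℚ-* : ∀ a b → ℕ→ℚ (a N.* b) ≡ ℕ→ℚ a Q.* ℕ→ℚ b
  ℕ→ℚ-* a b rewrite ℕ→ℚ≡mkℚ a | ℕ→ℚ≡mkℚ b = cong (_/ 1) (ℤP.pos-* a b)

  ℕ→ℚ-∑ : ∀ a n f → ℕ→ℚ (ℕ∑.∑ a n f) ≡ ℚ∑.∑ a n (λ k → ℕ→ℚ (f k))
  ℕ→ℚ-∑ a zero    f = refl
  ℕ→ℚ-∑ a (suc n) f = trans (ℕ→ℚ-+ (f a) _) (cong (λ s → ℕ→ℚ (f a) Q.+ s) (ℕ→ℚ-∑ (suc a) n f))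

  ∑ℚ≡∑ : ∀ a n f → ∑ℚ a n f ≡ ℚ∑.∑ a n f
  ∑ℚ≡∑ a zero    f = refl
  ∑ℚ≡∑ a (suc n) f = cong (λ s → f a Q.+ s) (∑ℚ≡∑ (suc a) n f)

  [1+n]*1/[1+n]≡1 : ∀ n → ℕ→ℚ (suc n) Q.* ((+ 1) / suc n) ≡ Q.1ℚ
  [1+n]*1/[1+n]≡1 n rewrite ℕ→ℚ≡mkℚ (suc n) | 1/[1+n]≡mkℚ n =
    *-inverseʳ (mkℚ (+ suc n) 0 (coprime-1 (suc n)))

  a/[1+n]≡a*1/[1+n] : ∀ a n → (+ a) / suc n ≡ ℕ→ℚ a Q.* ((+ 1) / suc n)
  a/[1+n]≡a*1/[1+n] a n rewrite ℕ→ℚ≡mkℚ a | 1/[1+n]≡mkℚ n =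
    /-cong (sym (ℤP.*-identityʳ (+ a))) (sym (*-identityˡ (suc n)))

module BernoulliNumbers where

  open import Data.Nat using (zero; _<_; z≤n; s≤s; _≟_; _<?_)
  open import Data.Nat.Properties using (≤-refl; ≤-pred; ≤∧≢⇒<; n≤1+n; m+n∸n≡m)
  open import Data.Nat.Combinatorics using (nCk≡nC[n∸k]; nC1≡n; nCn≡1)
  open import Data.Rational.Properties using (*-identityˡ; +-comm)
  open import Data.Vec using (Vec; []; _∷_; _∷ʳ_; lookup)
  open import Data.Fin using (fromℕ<; fromℕ)
  import Data.Fin as Fin
  open import Data.Fin.Properties using (fromℕ<-cong; fromℕ-def)
  open import Data.Product using (Σ; _,_; proj₁; proj₂)
  open import Data.Empty using (⊥-elim)
  open import Relation.Nullary using (yes; no)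
  open import Tactic.RingSolver using (solve-∀)
  open P using (refl; cong; cong₂; sym; trans)
  open P.≡-Reasoning
  open RationalArithmetic

  lookup-∷ʳ-fromℕ : ∀ {A : Set} {n} (xs : Vec A n) x → lookup (xs ∷ʳ x) (fromℕ n) ≡ x
  lookup-∷ʳ-fromℕ []       x = refl
  lookup-∷ʳ-fromℕ (y ∷ xs) x = lookup-∷ʳ-fromℕ xs x

  lookup-∷ʳ-fromℕ< : ∀ {A : Set} {n} (xs : Vec A n) x k (k<n : k < n) (k<1+n : k < suc n) →
    lookup (xs ∷ʳ x) (fromℕ< k<1+n) ≡ lookup xs (fromℕ< k<n)
  lookup-∷ʳ-fromℕ< (y ∷ xs) x zero    _         _           = refl
  lookup-∷ʳ-fromℕ< (y ∷ xs) x (suc k) (s≤s k<n) (s≤s k<1+n) = lookup-∷ʳ-fromℕ< xs x k k<n k<1+n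

  lookup-bernoulliVec : ∀ n k (k<1+n : k < suc n) → lookup (bernoulliVec n) (fromℕ< k<1+n) ≡ B k
  lookup-bernoulliVec zero    zero    _          = refl
  lookup-bernoulliVec zero    (suc k) (s≤s ())
  lookup-bernoulliVec (suc n) k       k<2+n with k ≟ suc n
  ... | yes refl = cong (lookup (bernoulliVec (suc n)))
                        (trans (fromℕ<-cong _ _ refl k<2+n ≤-refl) (sym (fromℕ-def (suc n))))
  ... | no k≢1+n = trans (lookup-∷ʳ-fromℕ< (bernoulliVec n) _ k k<1+n k<2+n) (lookup-bernoulliVec n k k<1+n)
    where
    k<1+n : k < suc n
    k<1+n = ≤∧≢⇒< (≤-pred k<2+n) k≢1+n

  private
    -- bernoulliVec reads the earlier entries through a function local to Defs; the Σ gives it a name.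
    B-suc-via-earlier : Σ (ℕ → ℕ → ℚ) λ earlier → ∀ n →
      B (suc n) ≡ Q.- (((+ 1) / suc (suc n)) Q.* (ℕ→ℚ (suc (suc n) C 0) Q.* lookup (bernoulliVec n) Fin.zero
                                                  Q.+ ∑ℚ 1 n (λ k → ℕ→ℚ (suc (suc n) C k) Q.* earlier n k)))
    B-suc-via-earlier = _ , λ n → lookup-∷ʳ-fromℕ (bernoulliVec n) _

    earlier : ℕ → ℕ → ℚ
    earlier = proj₁ B-suc-via-earlier

    earlier≡B : ∀ n k → k < suc n → earlier n k ≡ B k
    earlier≡B n k k<1+n with k <? suc n
    ... | yes k<1+n′ = lookup-bernoulliVec n k k<1+n′
    ... | no  k≮1+n  = ⊥-elim (k≮1+n k<1+n)

  B-suc : ∀ n → B (suc n) ≡ Q.- (((+ 1) / suc (suc n)) Q.* ℚ∑.∑ 0 (suc n) (λ k → ℕ→ℚ (suc (suc n) C k) Q.* B k))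
  B-suc n = trans (proj₂ B-suc-via-earlier n) (cong (λ s → Q.- (((+ 1) / suc (suc n)) Q.* s)) (cong₂ Q._+_
    (cong (ℕ→ℚ (suc (suc n) C 0) Q.*_) (lookup-bernoulliVec n 0 (s≤s z≤n)))
    (trans (∑ℚ≡∑ 1 n _) (ℚ∑.∑-cong-on 1 n (λ k _ k<1+n → cong (ℕ→ℚ (suc (suc n) C k) Q.*_) (earlier≡B n k k<1+n))))))

  [1+n]C[n]≡1+n : ∀ n → suc n C n ≡ suc n
  [1+n]C[n]≡1+n n = trans (nCk≡nC[n∸k] (n≤1+n n)) (trans (cong (suc n C_) (m+n∸n≡m 1 n)) (nC1≡n (suc n)))

  ∑C*B≡0 : ∀ m → ℚ∑.∑ 0 (suc (suc m)) (λ k → ℕ→ℚ (suc (suc m) C k) Q.* B k) ≡ Q.0ℚ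
  ∑C*B≡0 m = begin
    ℚ∑.∑ 0 (suc (suc m)) f                   ≡⟨ ℚ∑.∑-last 0 (suc m) f ⟩
    S Q.+ f (suc m)                          ≡⟨ cong (λ x → S Q.+ ℕ→ℚ x Q.* B (suc m)) ([1+n]C[n]≡1+n (suc m)) ⟩
    S Q.+ ℕ→ℚ (suc (suc m)) Q.* B (suc m)    ≡⟨ cong (λ x → S Q.+ ℕ→ℚ (suc (suc m)) Q.* x) (B-suc m) ⟩
    S Q.+ a Q.* Q.- (c Q.* S)                ≡⟨ regroup S a c ⟩
    (Q.1ℚ Q.- a Q.* c) Q.* S                 ≡⟨ cong (λ x → (Q.1ℚ Q.- x) Q.* S) ([1+n]*1/[1+n]≡1 (suc m)) ⟩
    (Q.1ℚ Q.- Q.1ℚ) Q.* S                    ≡⟨ vanish S ⟩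
    Q.0ℚ                                     ∎
    where
    f : ℕ → ℚ
    f k = ℕ→ℚ (suc (suc m) C k) Q.* B k
    S : ℚ
    S = ℚ∑.∑ 0 (suc m) f
    a : ℚ
    a = ℕ→ℚ (suc (suc m))
    c : ℚ
    c = (+ 1) / suc (suc m)
    regroup : ∀ s a c → s Q.+ a Q.* Q.- (c Q.* s) ≡ (Q.1ℚ Q.- a Q.* c) Q.* s
    regroup = solve-∀ ℚ-ring
    vanish : ∀ s → (Q.1ℚ Q.- Q.1ℚ) Q.* s ≡ Q.0ℚ
    vanish = solve-∀ ℚ-ring

  δ₁ : ℕ → ℚ
  δ₁ zero          = Q.0ℚ
  δ₁ (suc zero)    = Q.1ℚ
  δ₁ (suc (suc _)) = Q.0ℚ

  ∑C*B≡B+δ₁ : ∀ m → ℚ∑.∑ 0 (suc m) (λ i → ℕ→ℚ (m C i) Q.* B i) ≡ B m Q.+ δ₁ m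
  ∑C*B≡B+δ₁ zero          = refl
  ∑C*B≡B+δ₁ (suc zero)    = refl
  ∑C*B≡B+δ₁ (suc (suc m)) = begin
    ℚ∑.∑ 0 (suc (suc (suc m))) f   ≡⟨ ℚ∑.∑-last 0 (suc (suc m)) f ⟩
    ℚ∑.∑ 0 (suc (suc m)) f Q.+ f M ≡⟨ cong₂ Q._+_ (∑C*B≡0 m) (cong (λ x → ℕ→ℚ x Q.* B M) (nCn≡1 M)) ⟩
    Q.0ℚ Q.+ Q.1ℚ Q.* B M          ≡⟨ cong (Q.0ℚ Q.+_) (*-identityˡ (B M)) ⟩
    Q.0ℚ Q.+ B M                   ≡⟨ +-comm Q.0ℚ (B M) ⟩
    B M Q.+ Q.0ℚ                   ∎
    where
    M : ℕ
    M = suc (suc m)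
    f : ℕ → ℚ
    f i = ℕ→ℚ (M C i) Q.* B i

module Faulhaber where

  open import Data.Nat using (zero; _<_; s≤s)
  open import Data.Nat.Properties using (≤-pred; <⇒≤; m∸[m∸n]≡n; +-∸-assoc; n∸n≡0; m+n∸n≡m; m∸n+n≡m; +-suc)
    renaming (*-zeroʳ to ℕ-*-zeroʳ; *-distribˡ-+ to ℕ-*-distribˡ-+; +-identityʳ to ℕ-+-identityʳ)
  open import Data.Nat.Combinatorics using (nCk≡nC[n∸k]; k>n⇒nCk≡0)
  open import Data.Nat.Tactic.RingSolver using () renaming (solve-∀ to ℕ-solve-∀)
  open import Data.Rational.Properties
    using (*-zeroˡ; *-zeroʳ; *-identityʳ; +-identityˡ; +-identityʳ; *-distribˡ-+; *-assoc; +-comm)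
  open import Tactic.RingSolver using (solve-∀)
  open P using (cong; cong₂; sym; trans)
  open P.≡-Reasoning
  open RationalArithmetic
  open BernoulliNumbers using (∑C*B≡0; ∑C*B≡B+δ₁; δ₁; [1+n]C[n]≡1+n)
  open BinomialCoefficients using (nCi*[1+x]^[n∸i]≡∑)
  open PowerSums using (powerSum)

  faulhaberSum : ℕ → ℕ → ℚ
  faulhaberSum p n = ℚ∑.∑ 0 (suc p) (λ i → ℕ→ℚ ((suc p C i) N.* n ^ (suc p ∸ i)) Q.* B i)

  faulhaberSum-reverse : ∀ p n →
    faulhaberSum p n ≡ ℚ∑.∑ 1 (suc p) (λ r → ℕ→ℚ ((suc p C r) N.* n ^ r) Q.* B (suc p ∸ r))
  faulhaberSum-reverse p n =
    trans (ℚ∑.∑-reverse (suc p) (λ i → ℕ→ℚ ((suc p C i) N.* n ^ (suc p ∸ i)) Q.* B i))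
          (ℚ∑.∑-cong-on 1 (suc p) (λ r _ r<2+p →
             cong₂ (λ c k → ℕ→ℚ (c N.* n ^ k) Q.* B (suc p ∸ r))
                   (sym (nCk≡nC[n∸k] (≤-pred r<2+p))) (m∸[m∸n]≡n (≤-pred r<2+p))))

  ∑C*B-truncate : ∀ e r → 1 ≤ r → r ≤ e →
    ℚ∑.∑ 0 e (λ i → ℕ→ℚ ((e ∸ r) C i) Q.* B i) ≡ B (e ∸ r) Q.+ δ₁ (e ∸ r)
  ∑C*B-truncate e (suc r) _ 1+r≤e = begin
    ℚ∑.∑ 0 e g              ≡⟨ cong (λ k → ℚ∑.∑ 0 k g) 1+m+r≡e ⟨
    ℚ∑.∑ 0 (suc m N.+ r) g  ≡⟨ ℚ∑.∑-extend 0 (suc m) r g (λ i m<i _ →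
                                 trans (cong (λ c → ℕ→ℚ c Q.* B i) (k>n⇒nCk≡0 m<i)) (*-zeroˡ (B i))) ⟩
    ℚ∑.∑ 0 (suc m) g        ≡⟨ ∑C*B≡B+δ₁ m ⟩
    B m Q.+ δ₁ m            ∎
    where
    m : ℕ
    m = e ∸ suc r
    g : ℕ → ℚ
    g i = ℕ→ℚ (m C i) Q.* B i
    1+m+r≡e : suc m N.+ r ≡ e
    1+m+r≡e = trans (sym (+-suc m r)) (m∸n+n≡m 1+r≤e)

  ∑*δ₁-select : ∀ p (X : ℕ → ℚ) → ℚ∑.∑ 1 (suc (suc p)) (λ r → X r Q.* δ₁ (suc (suc p) ∸ r)) ≡ X (suc p)
  ∑*δ₁-select p X = begin
    ℚ∑.∑ 1 (suc (suc p)) f                           ≡⟨ ℚ∑.∑-last 1 (suc p) f ⟩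
    ℚ∑.∑ 1 (suc p) f Q.+ f (suc (suc p))
      ≡⟨ cong₂ Q._+_ (ℚ∑.∑-last 1 p f) (trans (cong (λ k → X (suc (suc p)) Q.* δ₁ k) (n∸n≡0 p)) (*-zeroʳ (X (suc (suc p))))) ⟩
    (ℚ∑.∑ 1 p f Q.+ f (suc p)) Q.+ Q.0ℚ              ≡⟨ +-identityʳ _ ⟩
    ℚ∑.∑ 1 p f Q.+ f (suc p)
      ≡⟨ cong₂ Q._+_ (ℚ∑.∑-vanishing 1 p f δ₁≡0) (trans (cong (λ k → X (suc p) Q.* δ₁ k) (m+n∸n≡m 1 p)) (*-identityʳ (X (suc p)))) ⟩
    Q.0ℚ Q.+ X (suc p)                               ≡⟨ +-identityˡ _ ⟩
    X (suc p)                                        ∎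
    where
    f : ℕ → ℚ
    f r = X r Q.* δ₁ (suc (suc p) ∸ r)
    δ₁≡0 : ∀ r → 1 ≤ r → r < 1 N.+ p → f r ≡ Q.0ℚ
    δ₁≡0 r _ (s≤s r≤p) = trans (cong (λ k → X r Q.* δ₁ k) (+-∸-assoc 2 r≤p)) (*-zeroʳ (X r))

  faulhaberSum-suc-expand : ∀ p n →
    faulhaberSum p (suc n) ≡ ℚ∑.∑ 0 (suc (suc p)) (λ r → ℕ→ℚ ((suc p C r) N.* n ^ r)
                                                     Q.* ℚ∑.∑ 0 (suc p) (λ i → ℕ→ℚ ((suc p ∸ r) C i) Q.* B i))
  faulhaberSum-suc-expand p n = begin
    faulhaberSum p (suc n)
      ≡⟨ ℚ∑.∑-cong-on 0 e (λ i _ i<e → cong (λ c → ℕ→ℚ c Q.* B i) (nCi*[1+x]^[n∸i]≡∑ e i n (<⇒≤ i<e))) ⟩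
    ℚ∑.∑ 0 e (λ i → ℕ→ℚ (ℕ∑.∑ 0 (suc e) (λ r → t r i)) Q.* B i)
      ≡⟨ ℚ∑.∑-cong 0 e (λ i → trans (cong (Q._* B i) (ℕ→ℚ-∑ 0 (suc e) (λ r → t r i)))
                                     (ℚ∑.∑-distribʳ 0 (suc e) (B i) (λ r → ℕ→ℚ (t r i)))) ⟩
    ℚ∑.∑ 0 e (λ i → ℚ∑.∑ 0 (suc e) (λ r → ℕ→ℚ (t r i) Q.* B i))
      ≡⟨ ℚ∑.∑-comm 0 e 0 (suc e) (λ i r → ℕ→ℚ (t r i) Q.* B i) ⟩
    ℚ∑.∑ 0 (suc e) (λ r → ℚ∑.∑ 0 e (λ i → ℕ→ℚ (t r i) Q.* B i))
      ≡⟨ ℚ∑.∑-cong 0 (suc e) (λ r → trans (ℚ∑.∑-cong 0 e (factor r))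
                                           (sym (ℚ∑.∑-distribˡ 0 e (X r) (λ i → ℕ→ℚ ((e ∸ r) C i) Q.* B i)))) ⟩
    ℚ∑.∑ 0 (suc e) (λ r → X r Q.* ℚ∑.∑ 0 e (λ i → ℕ→ℚ ((e ∸ r) C i) Q.* B i)) ∎
    where
    e : ℕ
    e = suc p
    X : ℕ → ℚ
    X r = ℕ→ℚ ((e C r) N.* n ^ r)
    t : ℕ → ℕ → ℕ
    t r i = (e C r) N.* ((e ∸ r) C i) N.* n ^ r
    factor : ∀ r i → ℕ→ℚ (t r i) Q.* B i ≡ X r Q.* (ℕ→ℚ ((e ∸ r) C i) Q.* B i)
    factor r i = begin
      ℕ→ℚ (t r i) Q.* B i
        ≡⟨ cong (λ c → ℕ→ℚ c Q.* B i) (swap-last (e C r) ((e ∸ r) C i) (n ^ r)) ⟩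
      ℕ→ℚ ((e C r) N.* n ^ r N.* ((e ∸ r) C i)) Q.* B i
        ≡⟨ cong (Q._* B i) (ℕ→ℚ-* ((e C r) N.* n ^ r) ((e ∸ r) C i)) ⟩
      X r Q.* ℕ→ℚ ((e ∸ r) C i) Q.* B i
        ≡⟨ *-assoc (X r) _ (B i) ⟩
      X r Q.* (ℕ→ℚ ((e ∸ r) C i) Q.* B i) ∎
      where
      swap-last : ∀ a b c → a N.* b N.* c ≡ a N.* c N.* b
      swap-last = ℕ-solve-∀

  faulhaberSum-suc : ∀ p n →
    faulhaberSum (suc p) (suc n) ≡ faulhaberSum (suc p) n Q.+ ℕ→ℚ (suc (suc p) N.* n ^ suc p)
  faulhaberSum-suc p n = begin
    faulhaberSum (suc p) (suc n)
      ≡⟨ faulhaberSum-suc-expand (suc p) n ⟩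
    X 0 Q.* ℚ∑.∑ 0 e (λ i → ℕ→ℚ (e C i) Q.* B i) Q.+ ℚ∑.∑ 1 e (λ r → X r Q.* G r)
      ≡⟨ cong (Q._+ ℚ∑.∑ 1 e (λ r → X r Q.* G r)) (trans (cong (X 0 Q.*_) (∑C*B≡0 p)) (*-zeroʳ (X 0))) ⟩
    Q.0ℚ Q.+ ℚ∑.∑ 1 e (λ r → X r Q.* G r)
      ≡⟨ +-identityˡ _ ⟩
    ℚ∑.∑ 1 e (λ r → X r Q.* G r)
      ≡⟨ ℚ∑.∑-cong-on 1 e (λ r 1≤r r<1+e → trans (cong (X r Q.*_) (∑C*B-truncate e r 1≤r (≤-pred r<1+e))) (*-distribˡ-+ (X r) _ _)) ⟩
    ℚ∑.∑ 1 e (λ r → X r Q.* B (e ∸ r) Q.+ X r Q.* δ₁ (e ∸ r))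
      ≡⟨ ℚ∑.∑-distrib-+ 1 e (λ r → X r Q.* B (e ∸ r)) (λ r → X r Q.* δ₁ (e ∸ r)) ⟩
    ℚ∑.∑ 1 e (λ r → X r Q.* B (e ∸ r)) Q.+ ℚ∑.∑ 1 e (λ r → X r Q.* δ₁ (e ∸ r))
      ≡⟨ cong₂ Q._+_ (sym (faulhaberSum-reverse (suc p) n)) (∑*δ₁-select p X) ⟩
    faulhaberSum (suc p) n Q.+ X (suc p)
      ≡⟨ cong (λ c → faulhaberSum (suc p) n Q.+ ℕ→ℚ (c N.* n ^ suc p)) ([1+n]C[n]≡1+n (suc p)) ⟩
    faulhaberSum (suc p) n Q.+ ℕ→ℚ (e N.* n ^ suc p) ∎
    where
    e : ℕ
    e = suc (suc p)
    X : ℕ → ℚ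
    X r = ℕ→ℚ ((e C r) N.* n ^ r)
    G : ℕ → ℚ
    G r = ℚ∑.∑ 0 e (λ i → ℕ→ℚ ((e ∸ r) C i) Q.* B i)

  faulhaber : ∀ p n → ℕ→ℚ (suc (suc p) N.* powerSum (suc p) n) ≡ faulhaberSum (suc p) n
  faulhaber p zero = trans (cong ℕ→ℚ (ℕ-*-zeroʳ (suc (suc p)))) (sym (ℚ∑.∑-vanishing 0 (suc (suc p)) _ 0^[e∸i]≡0))
    where
    0^[e∸i]≡0 : ∀ i → 0 ≤ i → i < suc (suc p) → ℕ→ℚ ((suc (suc p) C i) N.* 0 ^ (suc (suc p) ∸ i)) Q.* B i ≡ Q.0ℚ
    0^[e∸i]≡0 i _ (s≤s i≤1+p) = begin
      ℕ→ℚ ((suc (suc p) C i) N.* 0 ^ (suc (suc p) ∸ i)) Q.* B i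
        ≡⟨ cong (λ k → ℕ→ℚ ((suc (suc p) C i) N.* 0 ^ k) Q.* B i) (+-∸-assoc 1 i≤1+p) ⟩
      ℕ→ℚ ((suc (suc p) C i) N.* 0) Q.* B i                      ≡⟨ cong (λ c → ℕ→ℚ c Q.* B i) (ℕ-*-zeroʳ (suc (suc p) C i)) ⟩
      Q.0ℚ Q.* B i                                                ≡⟨ *-zeroˡ (B i) ⟩
      Q.0ℚ                                                        ∎
  faulhaber p (suc n) = begin
    ℕ→ℚ (e N.* powerSum (suc p) (suc n))               ≡⟨ cong (λ s → ℕ→ℚ (e N.* s)) (ℕ∑.∑-last 0 n (λ k → k ^ suc p)) ⟩
    ℕ→ℚ (e N.* (powerSum (suc p) n N.+ n ^ suc p))     ≡⟨ cong ℕ→ℚ (ℕ-*-distribˡ-+ e (powerSum (suc p) n) (n ^ suc p)) ⟩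
    ℕ→ℚ (e N.* powerSum (suc p) n N.+ e N.* n ^ suc p) ≡⟨ ℕ→ℚ-+ (e N.* powerSum (suc p) n) (e N.* n ^ suc p) ⟩
    ℕ→ℚ (e N.* powerSum (suc p) n) Q.+ ℕ→ℚ (e N.* n ^ suc p) ≡⟨ cong (Q._+ ℕ→ℚ (e N.* n ^ suc p)) (faulhaber p n) ⟩
    faulhaberSum (suc p) n Q.+ ℕ→ℚ (e N.* n ^ suc p)   ≡⟨ faulhaberSum-suc p n ⟨
    faulhaberSum (suc p) (suc n)                       ∎
    where
    e : ℕ
    e = suc (suc p)

  faulhaber-tail : ∀ p x →
    ℚ∑.∑ 1 (suc p) (λ i → ℕ→ℚ ((suc (suc p) C i) N.* x ^ (suc (suc p) ∸ i)) Q.* B i)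
      ≡ ℕ→ℚ (suc (suc p)) Q.* ℕ→ℚ (powerSum (suc p) x) Q.- ℕ→ℚ (x ^ suc (suc p))
  faulhaber-tail p x = begin
    S                                       ≡⟨ move (f 0) S ⟩
    (f 0 Q.+ S) Q.- f 0                     ≡⟨ cong₂ Q._-_ (sym (faulhaber p x)) f0≡x^e ⟩
    ℕ→ℚ (e N.* powerSum (suc p) x) Q.- ℕ→ℚ (x ^ e) ≡⟨ cong (Q._- ℕ→ℚ (x ^ e)) (ℕ→ℚ-* e (powerSum (suc p) x)) ⟩
    ℕ→ℚ e Q.* ℕ→ℚ (powerSum (suc p) x) Q.- ℕ→ℚ (x ^ e) ∎
    where
    e : ℕ
    e = suc (suc p)
    f : ℕ → ℚ
    f i = ℕ→ℚ ((e C i) N.* x ^ (e ∸ i)) Q.* B i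
    S : ℚ
    S = ℚ∑.∑ 1 (suc p) f
    move : ∀ a s → s ≡ (a Q.+ s) Q.- a
    move = solve-∀ ℚ-ring
    f0≡x^e : f 0 ≡ ℕ→ℚ (x ^ e)
    f0≡x^e = trans (*-identityʳ _) (cong ℕ→ℚ (ℕ-+-identityʳ (x ^ e)))

module DoublingDefect where

  open import Data.Nat.Properties using (≤-pred; n∸n≡0; ^-zeroˡ; *-assoc)
  open import Data.Nat.Combinatorics using (nCn≡1)
  open import Data.Rational.Properties using (*-zeroʳ; *-identityˡ; +-inverseʳ)
  open import Tactic.RingSolver using (solve-∀)
  open P using (cong; cong₂; sym; trans)
  open P.≡-Reasoning
  open RationalArithmetic
  open PowerSums using (powerSum; powerSum-0; powerSum-double)
  open PowersOfTwo using (n+n≡2*n; doubled-coefficient)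

  powerSumℚ : ℕ → ℕ → ℚ
  powerSumℚ p n = ℕ→ℚ (powerSum p n)

  defect : ℕ → ℕ → ℚ
  defect p M = powerSumℚ p (M N.+ M) Q.- ℕ→ℚ (2 ^ suc p) Q.* powerSumℚ p M

  powerSumℚ-double : ∀ p n → powerSumℚ p (n N.+ n) ≡
    powerSumℚ p n Q.+ ℚ∑.∑ 0 (suc p) (λ q → ℕ→ℚ ((p C q) N.* n ^ (p ∸ q)) Q.* powerSumℚ q n)
  powerSumℚ-double p n = begin
    powerSumℚ p (n N.+ n)                     ≡⟨ cong ℕ→ℚ (powerSum-double p n) ⟩
    ℕ→ℚ (powerSum p n N.+ ℕ∑.∑ 0 (suc p) g)   ≡⟨ ℕ→ℚ-+ (powerSum p n) _ ⟩
    powerSumℚ p n Q.+ ℕ→ℚ (ℕ∑.∑ 0 (suc p) g)  ≡⟨ cong (powerSumℚ p n Q.+_) (ℕ→ℚ-∑ 0 (suc p) g) ⟩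
    powerSumℚ p n Q.+ ℚ∑.∑ 0 (suc p) (λ q → ℕ→ℚ (g q))
      ≡⟨ cong (powerSumℚ p n Q.+_) (ℚ∑.∑-cong 0 (suc p) (λ q →
           trans (cong ℕ→ℚ (sym (*-assoc (p C q) (n ^ (p ∸ q)) (powerSum q n))))
                 (ℕ→ℚ-* ((p C q) N.* n ^ (p ∸ q)) (powerSum q n)))) ⟩
    powerSumℚ p n Q.+ ℚ∑.∑ 0 (suc p) (λ q → ℕ→ℚ ((p C q) N.* n ^ (p ∸ q)) Q.* powerSumℚ q n) ∎
    where
    g : ℕ → ℕ
    g q = (p C q) N.* (n ^ (p ∸ q) N.* powerSum q n)

  defect-double-∑ : ∀ p M → defect p (M N.+ M) ≡
    defect p M Q.+ ℚ∑.∑ 0 (suc p) (λ q → ℕ→ℚ ((p C q) N.* (M N.+ M) ^ (p ∸ q)) Q.* defect q M)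
  defect-double-∑ p M = begin
    powerSumℚ p (m N.+ m) Q.- z Q.* powerSumℚ p m
      ≡⟨ cong₂ (λ a b → a Q.- z Q.* b) (powerSumℚ-double p m) (powerSumℚ-double p M) ⟩
    (powerSumℚ p m Q.+ ℚ∑.∑ 0 (suc p) t₁) Q.- z Q.* (powerSumℚ p M Q.+ ℚ∑.∑ 0 (suc p) t₂)
      ≡⟨ regroup (powerSumℚ p m) (ℚ∑.∑ 0 (suc p) t₁) z (powerSumℚ p M) (ℚ∑.∑ 0 (suc p) t₂) ⟩
    defect p M Q.+ (ℚ∑.∑ 0 (suc p) t₁ Q.+ (Q.- z) Q.* ℚ∑.∑ 0 (suc p) t₂)
      ≡⟨ cong (λ s → defect p M Q.+ (ℚ∑.∑ 0 (suc p) t₁ Q.+ s)) (ℚ∑.∑-distribˡ 0 (suc p) (Q.- z) t₂) ⟩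
    defect p M Q.+ (ℚ∑.∑ 0 (suc p) t₁ Q.+ ℚ∑.∑ 0 (suc p) (λ q → (Q.- z) Q.* t₂ q))
      ≡⟨ cong (defect p M Q.+_) (sym (ℚ∑.∑-distrib-+ 0 (suc p) t₁ (λ q → (Q.- z) Q.* t₂ q))) ⟩
    defect p M Q.+ ℚ∑.∑ 0 (suc p) (λ q → t₁ q Q.+ (Q.- z) Q.* t₂ q)
      ≡⟨ cong (defect p M Q.+_) (ℚ∑.∑-cong-on 0 (suc p) (λ q _ q<1+p → termwise q (≤-pred q<1+p))) ⟩
    defect p M Q.+ ℚ∑.∑ 0 (suc p) (λ q → ℕ→ℚ ((p C q) N.* m ^ (p ∸ q)) Q.* defect q M) ∎
    where
    m : ℕ
    m = M N.+ M
    z : ℚ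
    z = ℕ→ℚ (2 ^ suc p)
    t₁ : ℕ → ℚ
    t₁ q = ℕ→ℚ ((p C q) N.* m ^ (p ∸ q)) Q.* powerSumℚ q m
    t₂ : ℕ → ℚ
    t₂ q = ℕ→ℚ ((p C q) N.* M ^ (p ∸ q)) Q.* powerSumℚ q M
    regroup : ∀ a s z b t → (a Q.+ s) Q.- z Q.* (b Q.+ t) ≡ (a Q.- z Q.* b) Q.+ (s Q.+ (Q.- z) Q.* t)
    regroup = solve-∀ ℚ-ring
    termwise : ∀ q → q ≤ p → t₁ q Q.+ (Q.- z) Q.* t₂ q ≡ ℕ→ℚ ((p C q) N.* m ^ (p ∸ q)) Q.* defect q M
    termwise q q≤p = begin
      a Q.* powerSumℚ q m Q.+ (Q.- z) Q.* (v Q.* powerSumℚ q M) ≡⟨ cong (a Q.* powerSumℚ q m Q.+_) (negate-assoc z v (powerSumℚ q M)) ⟩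
      a Q.* powerSumℚ q m Q.- z Q.* v Q.* powerSumℚ q M         ≡⟨ cong (λ x → a Q.* powerSumℚ q m Q.- x Q.* powerSumℚ q M) z*v≡a*zq ⟩
      a Q.* powerSumℚ q m Q.- a Q.* zq Q.* powerSumℚ q M        ≡⟨ factor a (powerSumℚ q m) zq (powerSumℚ q M) ⟩
      a Q.* defect q M                                          ∎
      where
      a : ℚ
      a = ℕ→ℚ ((p C q) N.* m ^ (p ∸ q))
      v : ℚ
      v = ℕ→ℚ ((p C q) N.* M ^ (p ∸ q))
      zq : ℚ
      zq = ℕ→ℚ (2 ^ suc q)
      negate-assoc : ∀ z v s → (Q.- z) Q.* (v Q.* s) ≡ Q.- (z Q.* v Q.* s)
      negate-assoc = solve-∀ ℚ-ring
      factor : ∀ a s zq t → a Q.* s Q.- a Q.* zq Q.* t ≡ a Q.* (s Q.- zq Q.* t)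
      factor = solve-∀ ℚ-ring
      z*v≡a*zq : z Q.* v ≡ a Q.* zq
      z*v≡a*zq = begin
        z Q.* v                                          ≡⟨ ℕ→ℚ-* (2 ^ suc p) ((p C q) N.* M ^ (p ∸ q)) ⟨
        ℕ→ℚ (2 ^ suc p N.* ((p C q) N.* M ^ (p ∸ q)))    ≡⟨ cong ℕ→ℚ (doubled-coefficient p q M q≤p) ⟩
        ℕ→ℚ ((p C q) N.* m ^ (p ∸ q) N.* 2 ^ suc q)      ≡⟨ ℕ→ℚ-* ((p C q) N.* m ^ (p ∸ q)) (2 ^ suc q) ⟩
        a Q.* zq                                         ∎

  defect-0 : ∀ M → defect 0 M ≡ Q.0ℚ
  defect-0 M = begin
    ℕ→ℚ (powerSum 0 (M N.+ M)) Q.- ℕ→ℚ 2 Q.* ℕ→ℚ (powerSum 0 M)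
      ≡⟨ cong₂ (λ a b → ℕ→ℚ a Q.- ℕ→ℚ 2 Q.* ℕ→ℚ b) (trans (powerSum-0 (M N.+ M)) (n+n≡2*n M)) (powerSum-0 M) ⟩
    ℕ→ℚ (2 N.* M) Q.- ℕ→ℚ 2 Q.* ℕ→ℚ M  ≡⟨ cong (Q._- ℕ→ℚ 2 Q.* ℕ→ℚ M) (ℕ→ℚ-* 2 M) ⟩
    ℕ→ℚ 2 Q.* ℕ→ℚ M Q.- ℕ→ℚ 2 Q.* ℕ→ℚ M ≡⟨ +-inverseʳ (ℕ→ℚ 2 Q.* ℕ→ℚ M) ⟩
    Q.0ℚ ∎

  defect-1 : ∀ p → defect (suc p) 1 ≡ Q.1ℚ
  defect-1 p = cong₂ (λ a b → ℕ→ℚ (a N.+ 0) Q.- b) (^-zeroˡ (suc p)) (*-zeroʳ (ℕ→ℚ (2 ^ suc (suc p))))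

  defect-double : ∀ p M → defect (suc p) (M N.+ M) ≡
    ℕ→ℚ 2 Q.* defect (suc p) M Q.+ ℚ∑.∑ 1 p (λ q → ℕ→ℚ ((suc p C q) N.* (M N.+ M) ^ (suc p ∸ q)) Q.* defect q M)
  defect-double p M = begin
    defect (suc p) (M N.+ M)
      ≡⟨ defect-double-∑ (suc p) M ⟩
    D Q.+ (f 0 Q.+ ℚ∑.∑ 1 (suc p) f)
      ≡⟨ cong₂ (λ a b → D Q.+ (a Q.+ b)) (trans (cong (c₀ Q.*_) (defect-0 M)) (*-zeroʳ c₀)) (ℚ∑.∑-last 1 p f) ⟩
    D Q.+ (Q.0ℚ Q.+ (S Q.+ f (suc p)))
      ≡⟨ cong (λ x → D Q.+ (Q.0ℚ Q.+ (S Q.+ x))) f[1+p]≡D ⟩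
    D Q.+ (Q.0ℚ Q.+ (S Q.+ D))
      ≡⟨ regroup D S ⟩
    ℕ→ℚ 2 Q.* D Q.+ S ∎
    where
    D : ℚ
    D = defect (suc p) M
    c₀ : ℚ
    c₀ = ℕ→ℚ ((suc p C 0) N.* (M N.+ M) ^ suc p)
    f : ℕ → ℚ
    f q = ℕ→ℚ ((suc p C q) N.* (M N.+ M) ^ (suc p ∸ q)) Q.* defect q M
    S : ℚ
    S = ℚ∑.∑ 1 p f
    regroup : ∀ d s → d Q.+ (Q.0ℚ Q.+ (s Q.+ d)) ≡ ℕ→ℚ 2 Q.* d Q.+ s
    regroup = solve-∀ ℚ-ring
    f[1+p]≡D : f (suc p) ≡ D
    f[1+p]≡D = trans (cong (λ x → ℕ→ℚ x Q.* D) (cong₂ (λ c k → c N.* (M N.+ M) ^ k) (nCn≡1 (suc p)) (n∸n≡0 p)))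
                     (*-identityˡ D)

module Kernel where

  open import Data.Nat using (_<_)
  open import Data.Nat.Properties using (≤-pred; <⇒≤; +-comm; +-suc; *-comm; *-identityˡ; m+[n∸m]≡n)
  open import Data.Rational.Properties using (*-identityʳ; *-assoc; *-distribˡ-+)
  open import Tactic.RingSolver using (solve-∀)
  open P using (cong; cong₂; sym; trans)
  open P.≡-Reasoning
  open RationalArithmetic
  open Faulhaber using (faulhaber-tail)
  open DoublingDefect using (powerSumℚ; defect; defect-1; defect-double)
  open PowersOfTwo using (2^n+2^n≡2^[1+n]; [m*n]^o≡m^o*n^o; kernel-weight; rescaled-coefficient)

  kernelScale : ℕ → ℕ → ℚ
  kernelScale l p = Q.- ((+ (2 ^ l)) / suc p)

  kernelWeight : ℕ → ℕ → ℕ → ℕ → ℕ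
  kernelWeight l p j i = (suc p C i) N.* (2 ^ i ∸ 1) N.* 2 ^ ((p ∸ i) N.* l N.+ (i ∸ 1) N.* j)

  kernelSum : ℕ → ℕ → ℕ → ℚ
  kernelSum l p j = ∑ℚ 1 p (λ i → ℕ→ℚ (kernelWeight l p j i) Q.* B i)

  kernel : ℕ → ℕ → ℕ → ℚ
  kernel l p j = kernelScale l p Q.* kernelSum l p j

  kernel-term : ∀ j e p i → 1 ≤ i → i ≤ p →
    ℕ→ℚ (2 ^ (j N.+ suc e)) Q.* (ℕ→ℚ (kernelWeight (j N.+ suc e) p j i) Q.* B i)
    ≡ (ℕ→ℚ (2 ^ (j N.* p)) Q.* ℕ→ℚ (2 ^ suc p)) Q.* (ℕ→ℚ ((suc p C i) N.* (2 ^ e) ^ (suc p ∸ i)) Q.* B i)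
      Q.+ (Q.- ℕ→ℚ (2 ^ (j N.* p))) Q.* (ℕ→ℚ ((suc p C i) N.* (2 ^ e N.+ 2 ^ e) ^ (suc p ∸ i)) Q.* B i)
  kernel-term j e p i 1≤i i≤p = begin
    u Q.* (t Q.* B i)                   ≡⟨ *-assoc u t (B i) ⟨
    (u Q.* t) Q.* B i                   ≡⟨ cong (Q._* B i) (move (u Q.* t) (y Q.* w) (y Q.* (z Q.* v)) u*t+y*w≡y*z*v) ⟩
    (y Q.* (z Q.* v) Q.- y Q.* w) Q.* B i ≡⟨ distribute y z v w (B i) ⟩
    (y Q.* z) Q.* (v Q.* B i) Q.+ (Q.- y) Q.* (w Q.* B i) ∎
    where
    l : ℕ
    l = j N.+ suc e
    c : ℕ
    c = suc p C i
    k : ℕ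
    k = suc p ∸ i
    u : ℚ
    u = ℕ→ℚ (2 ^ l)
    t : ℚ
    t = ℕ→ℚ (kernelWeight l p j i)
    y : ℚ
    y = ℕ→ℚ (2 ^ (j N.* p))
    z : ℚ
    z = ℕ→ℚ (2 ^ suc p)
    v : ℚ
    v = ℕ→ℚ (c N.* (2 ^ e) ^ k)
    w : ℚ
    w = ℕ→ℚ (c N.* (2 ^ e N.+ 2 ^ e) ^ k)
    move : ∀ x w r → x Q.+ w ≡ r → x ≡ r Q.- w
    move x w r x+w≡r = trans (add-sub x w) (cong (Q._- w) x+w≡r)
      where
      add-sub : ∀ x w → x ≡ x Q.+ w Q.- w
      add-sub = solve-∀ ℚ-ring
    distribute : ∀ y z v w b → (y Q.* (z Q.* v) Q.- y Q.* w) Q.* b ≡ (y Q.* z) Q.* (v Q.* b) Q.+ (Q.- y) Q.* (w Q.* b)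
    distribute = solve-∀ ℚ-ring
    u*t+y*w≡y*z*v : u Q.* t Q.+ y Q.* w ≡ y Q.* (z Q.* v)
    u*t+y*w≡y*z*v = begin
      u Q.* t Q.+ y Q.* w                 ≡⟨ cong₂ Q._+_ (ℕ→ℚ-* (2 ^ l) _) (ℕ→ℚ-* (2 ^ (j N.* p)) _) ⟨
      ℕ→ℚ a Q.+ ℕ→ℚ b                     ≡⟨ ℕ→ℚ-+ a b ⟨
      ℕ→ℚ (a N.+ b)                       ≡⟨ cong ℕ→ℚ (kernel-weight j e i p 1≤i i≤p) ⟩
      ℕ→ℚ (2 ^ (j N.* p) N.* (2 ^ suc p N.* (c N.* (2 ^ e) ^ k))) ≡⟨ ℕ→ℚ-* (2 ^ (j N.* p)) _ ⟩
      y Q.* ℕ→ℚ (2 ^ suc p N.* (c N.* (2 ^ e) ^ k))               ≡⟨ cong (y Q.*_) (ℕ→ℚ-* (2 ^ suc p) _) ⟩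
      y Q.* (z Q.* v)                     ∎
      where
      a : ℕ
      a = 2 ^ l N.* kernelWeight l p j i
      b : ℕ
      b = 2 ^ (j N.* p) N.* (c N.* (2 ^ e N.+ 2 ^ e) ^ k)

  kernel≡2^[jp]*defect : ∀ p j e → kernel (j N.+ suc e) (suc p) j ≡ ℕ→ℚ (2 ^ (j N.* suc p)) Q.* defect (suc p) (2 ^ e)
  kernel≡2^[jp]*defect p j e = begin
    kernelScale l (suc p) Q.* kernelSum l (suc p) j
      ≡⟨ cong (λ x → Q.- x Q.* kernelSum l (suc p) j) (a/[1+n]≡a*1/[1+n] (2 ^ l) (suc p)) ⟩
    Q.- (u Q.* c) Q.* kernelSum l (suc p) j
      ≡⟨ pull-scale u c (kernelSum l (suc p) j) ⟩
    Q.- c Q.* (u Q.* kernelSum l (suc p) j)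
      ≡⟨ cong (λ x → Q.- c Q.* x) scaled-kernelSum ⟩
    Q.- c Q.* ((y Q.* z) Q.* (E Q.* powerSumℚ (suc p) M Q.- Mᵉ) Q.+ (Q.- y) Q.* (E Q.* powerSumℚ (suc p) m Q.- z Q.* Mᵉ))
      ≡⟨ collect c y z E (powerSumℚ (suc p) M) (powerSumℚ (suc p) m) Mᵉ ⟩
    y Q.* (E Q.* c) Q.* defect (suc p) M
      ≡⟨ cong (λ x → y Q.* x Q.* defect (suc p) M) ([1+n]*1/[1+n]≡1 (suc p)) ⟩
    y Q.* Q.1ℚ Q.* defect (suc p) M
      ≡⟨ cong (Q._* defect (suc p) M) (*-identityʳ y) ⟩
    y Q.* defect (suc p) M ∎
    where
    l : ℕ
    l = j N.+ suc e
    M : ℕ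
    M = 2 ^ e
    m : ℕ
    m = M N.+ M
    u : ℚ
    u = ℕ→ℚ (2 ^ l)
    c : ℚ
    c = (+ 1) / suc (suc p)
    y : ℚ
    y = ℕ→ℚ (2 ^ (j N.* suc p))
    z : ℚ
    z = ℕ→ℚ (2 ^ suc (suc p))
    E : ℚ
    E = ℕ→ℚ (suc (suc p))
    Mᵉ : ℚ
    Mᵉ = ℕ→ℚ (M ^ suc (suc p))
    f : ℕ → ℚ
    f i = ℕ→ℚ (kernelWeight l (suc p) j i) Q.* B i
    g : ℕ → ℕ → ℚ
    g n i = ℕ→ℚ ((suc (suc p) C i) N.* n ^ (suc (suc p) ∸ i)) Q.* B i
    pull-scale : ∀ u c s → Q.- (u Q.* c) Q.* s ≡ Q.- c Q.* (u Q.* s)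
    pull-scale = solve-∀ ℚ-ring
    collect : ∀ c y z E PM Pm Mᵉ →
      Q.- c Q.* ((y Q.* z) Q.* (E Q.* PM Q.- Mᵉ) Q.+ (Q.- y) Q.* (E Q.* Pm Q.- z Q.* Mᵉ)) ≡ y Q.* (E Q.* c) Q.* (Pm Q.- z Q.* PM)
    collect = solve-∀ ℚ-ring
    m^e≡z*M^e : ℕ→ℚ (m ^ suc (suc p)) ≡ z Q.* Mᵉ
    m^e≡z*M^e = trans (cong ℕ→ℚ (trans (cong (_^ suc (suc p)) (2^n+2^n≡2^[1+n] e)) ([m*n]^o≡m^o*n^o 2 M (suc (suc p)))))
                      (ℕ→ℚ-* (2 ^ suc (suc p)) (M ^ suc (suc p)))
    scaled-kernelSum : u Q.* kernelSum l (suc p) j ≡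
      (y Q.* z) Q.* (E Q.* powerSumℚ (suc p) M Q.- Mᵉ) Q.+ (Q.- y) Q.* (E Q.* powerSumℚ (suc p) m Q.- z Q.* Mᵉ)
    scaled-kernelSum = begin
      u Q.* kernelSum l (suc p) j
        ≡⟨ cong (u Q.*_) (∑ℚ≡∑ 1 (suc p) f) ⟩
      u Q.* ℚ∑.∑ 1 (suc p) f
        ≡⟨ ℚ∑.∑-distribˡ 1 (suc p) u f ⟩
      ℚ∑.∑ 1 (suc p) (λ i → u Q.* f i)
        ≡⟨ ℚ∑.∑-cong-on 1 (suc p) (λ i 1≤i i<2+p → kernel-term j e (suc p) i 1≤i (≤-pred i<2+p)) ⟩
      ℚ∑.∑ 1 (suc p) (λ i → (y Q.* z) Q.* g M i Q.+ (Q.- y) Q.* g m i)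
        ≡⟨ ℚ∑.∑-distrib-+ 1 (suc p) (λ i → (y Q.* z) Q.* g M i) (λ i → (Q.- y) Q.* g m i) ⟩
      ℚ∑.∑ 1 (suc p) (λ i → (y Q.* z) Q.* g M i) Q.+ ℚ∑.∑ 1 (suc p) (λ i → (Q.- y) Q.* g m i)
        ≡⟨ cong₂ Q._+_ (ℚ∑.∑-distribˡ 1 (suc p) (y Q.* z) (g M)) (ℚ∑.∑-distribˡ 1 (suc p) (Q.- y) (g m)) ⟨
      (y Q.* z) Q.* ℚ∑.∑ 1 (suc p) (g M) Q.+ (Q.- y) Q.* ℚ∑.∑ 1 (suc p) (g m)
        ≡⟨ cong₂ (λ s t → (y Q.* z) Q.* s Q.+ (Q.- y) Q.* t) (faulhaber-tail p M)
                 (trans (faulhaber-tail p m) (cong (λ x → E Q.* powerSumℚ (suc p) m Q.- x) m^e≡z*M^e)) ⟩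
      (y Q.* z) Q.* (E Q.* powerSumℚ (suc p) M Q.- Mᵉ) Q.+ (Q.- y) Q.* (E Q.* powerSumℚ (suc p) m Q.- z Q.* Mᵉ) ∎

  kernel-diagonal : ∀ p j → kernel (suc j) (suc p) j ≡ ℕ→ℚ ((suc p C 0) N.* 2 ^ ((suc p ∸ 0) N.* j))
  kernel-diagonal p j = begin
    kernel (suc j) (suc p) j                      ≡⟨ cong (λ l → kernel l (suc p) j) (+-comm 1 j) ⟩
    kernel (j N.+ 1) (suc p) j                    ≡⟨ kernel≡2^[jp]*defect p j 0 ⟩
    ℕ→ℚ (2 ^ (j N.* suc p)) Q.* defect (suc p) 1  ≡⟨ cong (ℕ→ℚ (2 ^ (j N.* suc p)) Q.*_) (defect-1 p) ⟩
    ℕ→ℚ (2 ^ (j N.* suc p)) Q.* Q.1ℚ              ≡⟨ *-identityʳ _ ⟩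
    ℕ→ℚ (2 ^ (j N.* suc p))                       ≡⟨ cong ℕ→ℚ (trans (cong (2 ^_) (*-comm j (suc p))) (sym (*-identityˡ _))) ⟩
    ℕ→ℚ (1 N.* 2 ^ (suc p N.* j))                 ∎

  private
    kernel-recurrence-closed : ∀ p j e → kernel (j N.+ suc (suc e)) (suc p) j ≡
      ℕ→ℚ 2 Q.* kernel (j N.+ suc e) (suc p) j
        Q.+ ℚ∑.∑ 1 p (λ q → ℕ→ℚ ((suc p C q) N.* 2 ^ ((suc p ∸ q) N.* (j N.+ suc e))) Q.* kernel (j N.+ suc e) q j)
    kernel-recurrence-closed p j e = begin
      kernel (j N.+ suc (suc e)) (suc p) j
        ≡⟨ kernel≡2^[jp]*defect p j (suc e) ⟩
      y Q.* defect (suc p) (2 ^ suc e)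
        ≡⟨ cong (λ n → y Q.* defect (suc p) n) (2^n+2^n≡2^[1+n] e) ⟨
      y Q.* defect (suc p) (M N.+ M)
        ≡⟨ cong (y Q.*_) (defect-double p M) ⟩
      y Q.* (ℕ→ℚ 2 Q.* defect (suc p) M Q.+ ℚ∑.∑ 1 p g)
        ≡⟨ *-distribˡ-+ y _ _ ⟩
      y Q.* (ℕ→ℚ 2 Q.* defect (suc p) M) Q.+ y Q.* ℚ∑.∑ 1 p g
        ≡⟨ cong₂ Q._+_ (swap-front y (ℕ→ℚ 2) (defect (suc p) M)) (ℚ∑.∑-distribˡ 1 p y g) ⟩
      ℕ→ℚ 2 Q.* (y Q.* defect (suc p) M) Q.+ ℚ∑.∑ 1 p (λ q → y Q.* g q)
        ≡⟨ cong₂ Q._+_ (cong (ℕ→ℚ 2 Q.*_) (sym (kernel≡2^[jp]*defect p j e))) (ℚ∑.∑-cong-on 1 p termwise) ⟩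
      ℕ→ℚ 2 Q.* kernel l (suc p) j Q.+ ℚ∑.∑ 1 p (λ q → ℕ→ℚ ((suc p C q) N.* 2 ^ ((suc p ∸ q) N.* l)) Q.* kernel l q j) ∎
      where
      l : ℕ
      l = j N.+ suc e
      M : ℕ
      M = 2 ^ e
      y : ℚ
      y = ℕ→ℚ (2 ^ (j N.* suc p))
      g : ℕ → ℚ
      g q = ℕ→ℚ ((suc p C q) N.* (M N.+ M) ^ (suc p ∸ q)) Q.* defect q M
      swap-front : ∀ y t d → y Q.* (t Q.* d) ≡ t Q.* (y Q.* d)
      swap-front = solve-∀ ℚ-ring
      termwise : ∀ q → 1 ≤ q → q < 1 N.+ p → y Q.* g q ≡ ℕ→ℚ ((suc p C q) N.* 2 ^ ((suc p ∸ q) N.* l)) Q.* kernel l q j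
      termwise (suc q) _ q<1+p = begin
        y Q.* (a Q.* defect (suc q) M)  ≡⟨ *-assoc y a _ ⟨
        (y Q.* a) Q.* defect (suc q) M  ≡⟨ cong (Q._* defect (suc q) M) y*a≡c*yq ⟩
        (c Q.* yq) Q.* defect (suc q) M ≡⟨ *-assoc c yq _ ⟩
        c Q.* (yq Q.* defect (suc q) M) ≡⟨ cong (c Q.*_) (kernel≡2^[jp]*defect q j e) ⟨
        c Q.* kernel l (suc q) j        ∎
        where
        a : ℚ
        a = ℕ→ℚ ((suc p C suc q) N.* (M N.+ M) ^ (suc p ∸ suc q))
        c : ℚ
        c = ℕ→ℚ ((suc p C suc q) N.* 2 ^ ((suc p ∸ suc q) N.* l))
        yq : ℚ
        yq = ℕ→ℚ (2 ^ (j N.* suc q))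
        y*a≡c*yq : y Q.* a ≡ c Q.* yq
        y*a≡c*yq = begin
          y Q.* a ≡⟨ ℕ→ℚ-* (2 ^ (j N.* suc p)) _ ⟨
          ℕ→ℚ (2 ^ (j N.* suc p) N.* ((suc p C suc q) N.* (M N.+ M) ^ (suc p ∸ suc q)))
            ≡⟨ cong ℕ→ℚ (rescaled-coefficient j e (suc p) (suc q) (<⇒≤ q<1+p)) ⟩
          ℕ→ℚ ((suc p C suc q) N.* 2 ^ ((suc p ∸ suc q) N.* l) N.* 2 ^ (j N.* suc q))
            ≡⟨ ℕ→ℚ-* ((suc p C suc q) N.* 2 ^ ((suc p ∸ suc q) N.* l)) _ ⟩
          c Q.* yq ∎

  kernel-recurrence : ∀ p m j → j ≤ m → kernel (suc (suc m)) (suc p) j ≡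
    ℕ→ℚ 2 Q.* kernel (suc m) (suc p) j
      Q.+ ℚ∑.∑ 1 p (λ q → ℕ→ℚ ((suc p C q) N.* 2 ^ ((suc p ∸ q) N.* suc m)) Q.* kernel (suc m) q j)
  kernel-recurrence p m j j≤m = begin
    kernel (suc (suc m)) (suc p) j         ≡⟨ cong (λ l → kernel (suc l) (suc p) j) j+1+e≡1+m ⟨
    kernel (suc (j N.+ suc e)) (suc p) j   ≡⟨ cong (λ l → kernel l (suc p) j) (+-suc j (suc e)) ⟨
    kernel (j N.+ suc (suc e)) (suc p) j   ≡⟨ kernel-recurrence-closed p j e ⟩
    rhs (j N.+ suc e)                      ≡⟨ cong rhs j+1+e≡1+m ⟩
    rhs (suc m)                            ∎
    where
    e : ℕ
    e = m ∸ j
    j+1+e≡1+m : j N.+ suc e ≡ suc m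
    j+1+e≡1+m = trans (+-suc j e) (cong suc (m+[n∸m]≡n j≤m))
    rhs : ℕ → ℚ
    rhs l = ℕ→ℚ 2 Q.* kernel l (suc p) j
              Q.+ ℚ∑.∑ 1 p (λ q → ℕ→ℚ ((suc p C q) N.* 2 ^ ((suc p ∸ q) N.* l)) Q.* kernel l q j)

module Recurrence {r ℓ : Level} (R : CommutativeRing r ℓ)
                  (ι : ℚ → CommutativeRing.Carrier R) (ι-hom : IsℚAlgebraMap R ι) where

  open import Data.Nat using (zero; _<_; z≤n; s≤s)
  open import Data.Nat.Properties using (≤-pred)
  open import Algebra.Morphism.Structures using (module RingMorphisms)
  open CommutativeRing R
  open RingMorphisms.IsRingHomomorphism ι-hom using (+-homo; *-homo; 0#-homo)
  open import Relation.Binary.Reasoning.Setoid setoid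
  module ℚ∑ = RationalArithmetic.ℚ∑
  open Kernel
  module R∑ = FiniteSum commutativeSemiring

  ∑R≡∑ : ∀ a n f → ∑R R a n f ≡ R∑.∑ a n f
  ∑R≡∑ a zero    f = P.refl
  ∑R≡∑ a (suc n) f = P.cong (λ s → f a + s) (∑R≡∑ (suc a) n f)

  ι-∑ : ∀ a n f → ι (ℚ∑.∑ a n f) ≈ R∑.∑ a n (λ k → ι (f k))
  ι-∑ a zero    f = 0#-homo
  ι-∑ a (suc n) f = trans (+-homo (f a) _) (+-congˡ (ι-∑ (suc a) n f))

  ∑-kernel≈scale*∑ : ∀ l p n (a : ℕ → Carrier) →
    R∑.∑ 1 n (λ j → ι (kernel l p j) * a j) ≈ ι (kernelScale l p) * ∑R R 1 n (λ j → ι (kernelSum l p j) * a j)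
  ∑-kernel≈scale*∑ l p n a = begin
    R∑.∑ 1 n (λ j → ι (kernelScale l p Q.* kernelSum l p j) * a j)
      ≈⟨ R∑.∑-cong 1 n (λ j → trans (*-congʳ (*-homo _ _)) (*-assoc _ _ _)) ⟩
    R∑.∑ 1 n (λ j → ι (kernelScale l p) * (ι (kernelSum l p j) * a j))
      ≈⟨ R∑.∑-distribˡ 1 n (ι (kernelScale l p)) _ ⟨
    ι (kernelScale l p) * R∑.∑ 1 n (λ j → ι (kernelSum l p j) * a j)
      ≡⟨ P.cong (ι (kernelScale l p) *_) (∑R≡∑ 1 n _) ⟨
    ι (kernelScale l p) * ∑R R 1 n (λ j → ι (kernelSum l p j) * a j) ∎

  module _ (z : ℕ → ℕ → Carrier) (z-0 : ∀ p → z 0 p ≈ 0#)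
           (z-rec : ∀ l p → 1 ≤ l → 1 ≤ p →
             z l p ≈ ι (ℕ→ℚ 2) * z (l ∸ 1) p
                     + ∑R R 0 p (λ q → ι (ℕ→ℚ ((p C q) N.* 2 ^ ((p ∸ q) N.* (l ∸ 1)))) * z (l ∸ 1) q)) where

    expansion : ℕ → ℕ → Carrier
    expansion l p = R∑.∑ 1 (l ∸ 1) (λ j → ι (kernel l p j) * z j 0)

    z≈expansion : ∀ l p → 1 ≤ p → z l p ≈ expansion l p
    z≈expansion zero          p       _   = z-0 p
    z≈expansion (suc zero)    p       1≤p = begin
      z 1 p                                 ≈⟨ z-rec 1 p (s≤s z≤n) 1≤p ⟩
      ι (ℕ→ℚ 2) * z 0 p + ∑R R 0 p first-step ≈⟨ +-cong (trans (*-congˡ (z-0 p)) (zeroʳ _))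
                                                         (trans (reflexive (∑R≡∑ 0 p first-step))
                                                                (R∑.∑-vanishing 0 p first-step (λ q _ _ → trans (*-congˡ (z-0 q)) (zeroʳ _)))) ⟩
      0# + 0#                               ≈⟨ +-identityˡ 0# ⟩
      0#                                    ∎
      where
      first-step : ℕ → Carrier
      first-step q = ι (ℕ→ℚ ((p C q) N.* 2 ^ ((p ∸ q) N.* 0))) * z 0 q
    z≈expansion (suc (suc m)) zero    ()
    z≈expansion (suc (suc m)) (suc p) _   = begin
      z (suc (suc m)) (suc p)
        ≈⟨ z-rec (suc (suc m)) (suc p) (s≤s z≤n) (s≤s z≤n) ⟩
      ι (ℕ→ℚ 2) * z (suc m) (suc p) + (Y + ∑R R 1 p (λ q → ι (c q) * z (suc m) q))
        ≈⟨ +-cong (*-congˡ (z≈expansion (suc m) (suc p) (s≤s z≤n)))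
                  (+-congˡ (trans (reflexive (∑R≡∑ 1 p _)) (R∑.∑-cong-on 1 p (λ q 1≤q _ → *-congˡ (z≈expansion (suc m) q 1≤q))))) ⟩
      X + (Y + Z)
        ≈⟨ trans (+-congˡ (+-comm Y Z)) (sym (+-assoc X Z Y)) ⟩
      (X + Z) + Y
        ≈⟨ expansion-step ⟨
      expansion (suc (suc m)) (suc p) ∎
      where
      a : ℕ → Carrier
      a j = z j 0
      c : ℕ → ℚ
      c q = ℕ→ℚ ((suc p C q) N.* 2 ^ ((suc p ∸ q) N.* suc m))
      X : Carrier
      X = ι (ℕ→ℚ 2) * expansion (suc m) (suc p)
      Y : Carrier
      Y = ι (c 0) * a (suc m)
      Z : Carrier
      Z = R∑.∑ 1 p (λ q → ι (c q) * expansion (suc m) q)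
      termwise : ∀ j → 1 ≤ j → j < 1 N.+ m → ι (kernel (suc (suc m)) (suc p) j) * a j
        ≈ ι (ℕ→ℚ 2) * (ι (kernel (suc m) (suc p) j) * a j) + R∑.∑ 1 p (λ q → ι (c q) * (ι (kernel (suc m) q j) * a j))
      termwise j _ j<1+m = begin
        ι (kernel (suc (suc m)) (suc p) j) * a j
          ≈⟨ *-congʳ (reflexive (P.cong ι (kernel-recurrence p m j (≤-pred j<1+m)))) ⟩
        ι (ℕ→ℚ 2 Q.* kernel (suc m) (suc p) j Q.+ ℚ∑.∑ 1 p (λ q → c q Q.* kernel (suc m) q j)) * a j
          ≈⟨ *-congʳ (trans (+-homo _ _) (+-cong (*-homo _ _) (trans (ι-∑ 1 p _) (R∑.∑-cong 1 p (λ q → *-homo (c q) (kernel (suc m) q j)))))) ⟩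
        (ι (ℕ→ℚ 2) * ι (kernel (suc m) (suc p) j) + R∑.∑ 1 p (λ q → ι (c q) * ι (kernel (suc m) q j))) * a j
          ≈⟨ distribʳ (a j) _ _ ⟩
        ι (ℕ→ℚ 2) * ι (kernel (suc m) (suc p) j) * a j + R∑.∑ 1 p (λ q → ι (c q) * ι (kernel (suc m) q j)) * a j
          ≈⟨ +-cong (*-assoc _ _ _) (trans (R∑.∑-distribʳ 1 p (a j) _) (R∑.∑-cong 1 p (λ q → *-assoc _ _ _))) ⟩
        ι (ℕ→ℚ 2) * (ι (kernel (suc m) (suc p) j) * a j) + R∑.∑ 1 p (λ q → ι (c q) * (ι (kernel (suc m) q j) * a j)) ∎
      expansion-step : expansion (suc (suc m)) (suc p) ≈ (X + Z) + Y
      expansion-step = begin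
        R∑.∑ 1 (suc m) (λ j → ι (kernel (suc (suc m)) (suc p) j) * a j)
          ≈⟨ R∑.∑-last 1 m _ ⟩
        R∑.∑ 1 m (λ j → ι (kernel (suc (suc m)) (suc p) j) * a j) + ι (kernel (suc (suc m)) (suc p) (suc m)) * a (suc m)
          ≈⟨ +-cong (R∑.∑-cong-on 1 m termwise) (*-congʳ (reflexive (P.cong ι (kernel-diagonal p (suc m))))) ⟩
        R∑.∑ 1 m (λ j → ι (ℕ→ℚ 2) * (ι (kernel (suc m) (suc p) j) * a j) + R∑.∑ 1 p (λ q → ι (c q) * (ι (kernel (suc m) q j) * a j))) + Y
          ≈⟨ +-congʳ (R∑.∑-distrib-+ 1 m _ _) ⟩
        (R∑.∑ 1 m (λ j → ι (ℕ→ℚ 2) * (ι (kernel (suc m) (suc p) j) * a j))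
          + R∑.∑ 1 m (λ j → R∑.∑ 1 p (λ q → ι (c q) * (ι (kernel (suc m) q j) * a j)))) + Y
          ≈⟨ +-congʳ (+-cong (sym (R∑.∑-distribˡ 1 m (ι (ℕ→ℚ 2)) _))
                             (trans (R∑.∑-comm 1 m 1 p (λ j q → ι (c q) * (ι (kernel (suc m) q j) * a j)))
                                    (R∑.∑-cong 1 p (λ q → sym (R∑.∑-distribˡ 1 m (ι (c q)) _))))) ⟩
        (X + Z) + Y ∎

lemma3 : {c ℓ : Level} (R : CommutativeRing c ℓ) →
    let open CommutativeRing R in
    (ι : ℚ → Carrier) → IsℚAlgebraMap R ι →
    (z : ℕ → ℕ → Carrier) →
    (∀ p → z 0 p ≈ 0#) →
    (∀ l p → 1 ≤ l → 1 ≤ p →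
      z l p ≈ ι (ℕ→ℚ 2) * z (l ∸ 1) p
              + ∑R R 0 p (λ q → ι (ℕ→ℚ ((p C q) N.* 2 ^ ((p ∸ q) N.* (l ∸ 1)))) * z (l ∸ 1) q)) →
    ∀ l p → 1 ≤ p →
      z l p ≈ ι (Q.- ((+ (2 ^ l)) / suc p))
              * ∑R R 1 (l ∸ 1) (λ j →
                  ι (∑ℚ 1 p (λ i →
                       ℕ→ℚ ((suc p C i) N.* (2 ^ i ∸ 1) N.* 2 ^ ((p ∸ i) N.* l N.+ (i ∸ 1) N.* j))
                       Q.* B i))
                  * z j 0)
lemma3 R ι ι-hom z z-0 z-rec l p 1≤p =
  trans (z≈expansion z z-0 z-rec l p 1≤p) (∑-kernel≈scale*∑ l p (l ∸ 1) (λ j → z j 0))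
  where
  open CommutativeRing R using (trans)
  open Recurrence R ι ι-hom
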